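{- For any mixed graph $D=(V,A)$, $$(y+1)^{|E(D)|+\mathrm{c}(D)-|V|}\,T^{(1)}_D\!\left(y+2,\frac{y}{y+1}\right)=\sum_{\substack{S\subseteq A\\ D_{\setminus S}\text{ acyclic}}} y^{|E(D)|-|A\setminus S|}.$$
   Context: Digraphs are finite, loops and multiple arcs allowed. The $B$-polynomial $B_D(q,y,z)$ is the unique polynomial such that for every positive integer $q$, $B_D(q,y,z)=\sum_{f:V\to\{1,\dots,q\}} y^{\#\{(u,v)\in A: f(v)>f(u)\}} z^{\#\{(u,v)\in A: f(v)<f(u)\}}$. A mixed graph is a digraph $D=(V,A)$ with a partition $E(D)$ of $A$ into singletons (oriented edges) and doubletons $\{(u,v),(v,u)\}$ of opposite arcs (unoriented edges); $|E(D)|$ is the number of parts. $\mathrm{c}(D)$ is the number of connected components of the underlying graph. $T^{(1)}_D(x,y)=\frac{y^{|E(D)|}}{(y-1)^{|V|}(x-1)^{\mathrm{c}(D)}}B_D\big((x-1)(y-1),\tfrac1y,1\big)$ (a polynomial in $x,y$). $D_{\setminus S}$ is obtained by deleting the arcs of $S$; acyclic means no directed cycle. -}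

module Defs where

open import Data.Nat as ℕ using (ℕ; zero; suc; _<_; _≤_)
open import Data.Integer as ℤ using (ℤ)
open import Data.Rational as ℚ using (ℚ; 0ℚ; 1ℚ; _+_; _*_; _-_; _÷_)
open import Data.Rational.Properties using (_≟_)
open import Data.Fin using (Fin; toℕ)
open import Data.Fin.Subset using (Subset; _∉_; ∁; ∣_∣)
open import Data.Vec using (Vec; []; _∷_; lookup)
open import Data.List as List using (List; []; _∷_; _++_; map; concatMap; filter; allFin)
open import Data.Bool using (Bool; true; false; if_then_else_)
open import Data.Product using (_×_; _,_; Σ; ∃)
open import Relation.Nullary using (Dec; yes; no; ¬_; does)
open import Relation.Binary.PropositionalEquality using (_≡_; _≢_)

-- Vertex set V = Fin n, arc set A = Fin m (multiple arcs and loops allowed),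
-- arc a goes from (tail a) to (head a).
-- The partition E(D) of A into singletons and doubletons of opposite arcs is
-- encoded by an involution `partner` on A: the part of a is {a, partner a}.
-- If partner a = a, {a} is an oriented edge; otherwise {a, partner a} is an
-- unoriented edge and the two arcs must be opposite.

record MixedGraph : Set where
  field
    n       : ℕ
    m       : ℕ
    tail    : Fin m → Fin n
    head    : Fin m → Fin n
    partner : Fin m → Fin m
    partner-invol    : ∀ a → partner (partner a) ≡ a
    partner-opp-tail : ∀ a → partner a ≢ a → tail (partner a) ≡ head a
    partner-opp-head : ∀ a → partner a ≢ a → head (partner a) ≡ tail a

open MixedGraph public

sumℚ : ∀ {A : Set} → List A → (A → ℚ) → ℚ
sumℚ []       f = 0ℚ
sumℚ (x ∷ xs) f = f x + sumℚ xs f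

allB : ∀ {A : Set} → (A → Bool) → List A → Bool
allB p []       = true
allB p (x ∷ xs) = if p x then allB p xs else false

count : ∀ {A : Set} → List A → (A → Bool) → ℕ
count []       p = 0
count (x ∷ xs) p = if p x then suc (count xs p) else count xs p

allVecs : (q k : ℕ) → List (Vec (Fin q) k)
allVecs q zero    = [] ∷ []
allVecs q (suc k) = concatMap (λ i → map (i ∷_) (allVecs q k)) (allFin q)

allSubsets : (k : ℕ) → List (Subset k)
allSubsets zero    = [] ∷ []
allSubsets (suc k) = concatMap (λ b → map (b ∷_) (allSubsets k)) (true ∷ false ∷ [])

_^_ : ℚ → ℕ → ℚ
x ^ zero  = 1ℚ
x ^ suc k = x * (x ^ k)

-- total division on ℚ (x / 0 := 0); only used at nonzero denominators
_÷'_ : ℚ → ℚ → ℚ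
x ÷' y with y ≟ 0ℚ
... | yes _ = 0ℚ
... | no y≢0 = _÷_ x y {{ℚ.≢-nonZero y≢0}}

ℕ→ℚ : ℕ → ℚ
ℕ→ℚ k = ℤ.+ k ℚ./ 1

-- |E(D)| : number of parts of the partition (one representative a per part:
-- the one with toℕ a ≤ toℕ (partner a)).

numEdges : MixedGraph → ℕ
numEdges D = count (allFin (m D)) (λ a → does (toℕ a ℕ.≤? toℕ (partner D a)))

data Connected (D : MixedGraph) : Fin (n D) → Fin (n D) → Set where
  here : ∀ {u} → Connected D u u
  fwd  : ∀ {u} a → Connected D u (tail D a) → Connected D u (head D a)
  bwd  : ∀ {u} a → Connected D u (head D a) → Connected D u (tail D a)

-- c(D): number of components = number of vertices v that are the least
-- (by index) vertex of their component.  Defined relative to any decision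
-- procedure for Connected (the value does not depend on the choice).
numComponents : (D : MixedGraph) → (∀ u v → Dec (Connected D u v)) → ℕ
numComponents D conn? =
  count (allFin (n D))
    (λ v → allB (λ u → Data.Bool.not (does (toℕ u ℕ.<? toℕ v)) Data.Bool.∨
                             Data.Bool.not (does (conn? u v)))
                    (allFin (n D)))
  where import Data.Bool

data Walk⁺ (D : MixedGraph) (S : Subset (m D)) : Fin (n D) → Fin (n D) → Set where
  step : ∀ a → a ∉ S → Walk⁺ D S (tail D a) (head D a)
  cons : ∀ a {v} → a ∉ S → Walk⁺ D S (head D a) v → Walk⁺ D S (tail D a) v

Acyclic : (D : MixedGraph) → Subset (m D) → Set
Acyclic D S = ∀ v → ¬ Walk⁺ D S v v

-- The B-polynomial at a positive integer q (as a sum over colourings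
-- f : V → {1..q}, encoded as Fin q with the same order).

ascents descents : (D : MixedGraph) {q : ℕ} → Vec (Fin q) (n D) → ℕ
ascents  D f = count (allFin (m D)) (λ a → does (toℕ (lookup f (tail D a)) ℕ.<? toℕ (lookup f (head D a))))
descents D f = count (allFin (m D)) (λ a → does (toℕ (lookup f (head D a)) ℕ.<? toℕ (lookup f (tail D a))))

Bsum : MixedGraph → ℕ → ℚ → ℚ → ℚ
Bsum D q y z = sumℚ (allVecs q (n D)) (λ f → (y ^ ascents D f) * (z ^ descents D f))

Poly3 : Set
Poly3 = List (ℚ × ℕ × ℕ × ℕ)

eval3 : Poly3 → ℚ → ℚ → ℚ → ℚ
eval3 P q y z = sumℚ P (λ { (c , i , j , k) → c * ((q ^ i) * ((y ^ j) * (z ^ k))) })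

IsBPoly : MixedGraph → Poly3 → Set
IsBPoly D P = ∀ q → 1 ≤ q → ∀ y z → eval3 P (ℕ→ℚ q) y z ≡ Bsum D q y z

T1 : (D : MixedGraph) → (∀ u v → Dec (Connected D u v)) → Poly3 → ℚ → ℚ → ℚ
T1 D conn? P x y =
  ((y ^ numEdges D) ÷' (((y - 1ℚ) ^ n D) * ((x - 1ℚ) ^ numComponents D conn?)))
  * eval3 P ((x - 1ℚ) * (y - 1ℚ)) (1ℚ ÷' y) 1ℚ

acyclicSum : (D : MixedGraph) → (∀ S → Dec (Acyclic D S)) → ℚ → ℚ
acyclicSum D acyc? y =
  sumℚ (allSubsets (m D))
    (λ S → if does (acyc? S) then y ^ (numEdges D ℕ.∸ ∣ ∁ S ∣) else 0ℚ)

module Submission where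

-- With t = 1/y, expanding each factor of (1 + t)^#ascents over the arcs that ascend gives
-- B_D(q, 1 + t, 1) = ∑_S t^|A ∖ S| Ω°_{D ∖ S}(q), where Ω°_{D ∖ S} is the strict order polynomial of
-- D ∖ S.  Both sides are polynomials in q agreeing at every q ≥ 1, so finite differences identify
-- their values at q = −1, where Stanley reciprocity gives Ω°_{D ∖ S}(−1) = (−1)^|V| if D ∖ S is
-- acyclic and 0 otherwise.  Reciprocity is proved by splitting off the top colour class, which is a
-- set of sinks, and summing (−1)^|U| over the nonempty sets U of sinks.  At x = y + 2 and
-- y/(y + 1) one has (x − 1)(y/(y + 1) − 1) = −1 and (y + 1)/y = 1 + t, so T¹ collapses to
-- y^|E| (y + 1)^(|V| − |E| − c) ∑_{S acyclic} y^−|A ∖ S|.  The factor (y + 1)^(|E| + c − |V|)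
-- cancels the middle term because |V| ≤ |E| + c (each edge merges at most two components), and
-- y^|E| y^−|A ∖ S| is a monomial because an acyclic D ∖ S keeps at most one arc of each
-- unoriented edge.

open import Defs
open import Data.Nat as ℕ using (ℕ; zero; suc; z≤n; s≤s; _≤_; _<_)
import Data.Nat.Properties as ℕ
open import Data.Nat.Induction using (<-rec)
import Data.Nat.Coprimality as Coprime
import Data.Integer as ℤ
import Data.Integer.Properties as ℤ
open import Data.Rational as ℚ using (ℚ; 0ℚ; 1ℚ; _+_; _*_; _-_; -_; 1/_; mkℚ)
import Data.Rational.Properties as ℚ
import Data.Rational.Unnormalised as ℚᵘ
import Data.Rational.Unnormalised.Properties as ℚᵘ
open import Data.Rational.Solver using (module +-*-Solver)
open import Data.Bool as Bool using (Bool; true; false; if_then_else_; T; _∧_; _∨_; not)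
open import Data.Bool.Properties using (T-≡; T-∧; ∧-comm)
import Data.Bool.Properties
open import Data.Fin as Fin using (Fin; zero; suc; toℕ; fromℕ; fromℕ<; inject₁)
import Data.Fin.Properties as Fin
import Data.Fin.Permutation as Permutation
open import Data.Fin.Subset using (Subset; Nonempty; _∈_; _∉_; _⊆_; _─_; ∁; ∣_∣; ⊤; inside; outside) renaming (⊥ to ∅)
open import Data.Fin.Subset.Properties
  using (nonempty?; _⊆?_; _∈?_; drop-∷-⊆; ⊥⊆; p─⊥≡p; x∈p∩q⁺; p∩q≢∅⇒∣p─q∣<∣p∣; x∈p⇒∣p-x∣<∣p∣; Empty-unique; ∣⊥∣≡0; ∣⊤∣≡n)
open import Data.List using (List; []; _∷_; _++_; map; concatMap; allFin; tabulate)
open import Data.Vec as Vec using (Vec; []; _∷_; lookup; here; there)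
import Data.Vec.Properties as Vec
open import Data.Product using (Σ; ∃; ∃₂; _×_; _,_; proj₁; proj₂)
open import Data.Sum using (_⊎_; inj₁; inj₂)
open import Data.Unit using (tt)
open import Data.Empty using (⊥-elim)
open import Function using (_∘_; _⇔_; mk⇔; Equivalence)
open import Relation.Nullary using (Dec; yes; no; does; ¬_; contradiction)
open import Relation.Nullary.Decidable
  using (_×-dec_; _⊎-dec_; _→-dec_; ¬?; T?; map′; does-⇔; dec-true; dec-false; decidable-stable)
open import Relation.Binary using (tri<; tri≈; tri>)
open import Relation.Binary.PropositionalEquality
open import Algebra.Bundles using (CommutativeRing; CommutativeMonoid)
import Algebra.Properties.CommutativeSemiring.Exp as CommutativeSemiringExp
import Algebra.Properties.CommutativeSemigroup as CommutativeSemigroupProperties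
import Algebra.Properties.CommutativeMonoid.Sum as CommutativeMonoidSum

open +-*-Solver using (solve; _:=_; _:+_; _:-_; _:*_; :-_; con)
open CommutativeMonoidSum ℕ.+-0-commutativeMonoid using (sum; sum-permute)

module Exp = CommutativeSemiringExp (CommutativeRing.commutativeSemiring ℚ.+-*-commutativeRing)
module ℚ+ = CommutativeSemigroupProperties (CommutativeMonoid.commutativeSemigroup ℚ.+-0-commutativeMonoid)
module ℚ* = CommutativeSemigroupProperties (CommutativeMonoid.commutativeSemigroup ℚ.*-1-commutativeMonoid)


^≗Exp-^ : ∀ x k → x ^ k ≡ x Exp.^ k
^≗Exp-^ x zero    = refl
^≗Exp-^ x (suc k) = cong (x *_) (^≗Exp-^ x k)

^-distribˡ-+-* : ∀ x a b → x ^ (a ℕ.+ b) ≡ x ^ a * x ^ b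
^-distribˡ-+-* x a b
  rewrite ^≗Exp-^ x (a ℕ.+ b) | ^≗Exp-^ x a | ^≗Exp-^ x b = Exp.^-homo-* x a b

^-distribʳ-* : ∀ x y k → (x * y) ^ k ≡ x ^ k * y ^ k
^-distribʳ-* x y k
  rewrite ^≗Exp-^ (x * y) k | ^≗Exp-^ x k | ^≗Exp-^ y k = Exp.^-distrib-* x y k

1^k≡1 : ∀ k → 1ℚ ^ k ≡ 1ℚ
1^k≡1 zero    = refl
1^k≡1 (suc k) = cong (1ℚ *_) (1^k≡1 k)

^-inverse : ∀ {x y} k → x * y ≡ 1ℚ → x ^ k * y ^ k ≡ 1ℚ
^-inverse {x} {y} k xy≡1 = begin
  x ^ k * y ^ k ≡⟨ ^-distribʳ-* x y k ⟨
  (x * y) ^ k   ≡⟨ cong (_^ k) xy≡1 ⟩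
  1ℚ ^ k        ≡⟨ 1^k≡1 k ⟩
  1ℚ            ∎
  where open ≡-Reasoning

-1^-split : ∀ {a b c} → a ℕ.+ b ≡ c → (- 1ℚ) ^ a ≡ (- 1ℚ) ^ c * (- 1ℚ) ^ b
-1^-split {a} {b} refl = begin
  (- 1ℚ) ^ a                                ≡⟨ ℚ.*-identityʳ _ ⟨
  (- 1ℚ) ^ a * 1ℚ                           ≡⟨ cong ((- 1ℚ) ^ a *_) (^-inverse b refl) ⟨
  (- 1ℚ) ^ a * ((- 1ℚ) ^ b * (- 1ℚ) ^ b)    ≡⟨ ℚ.*-assoc ((- 1ℚ) ^ a) ((- 1ℚ) ^ b) ((- 1ℚ) ^ b) ⟨
  (- 1ℚ) ^ a * (- 1ℚ) ^ b * (- 1ℚ) ^ b      ≡⟨ cong (_* (- 1ℚ) ^ b) (^-distribˡ-+-* (- 1ℚ) a b) ⟨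
  (- 1ℚ) ^ (a ℕ.+ b) * (- 1ℚ) ^ b           ∎
  where open ≡-Reasoning

ℕ→ℚ≡mkℚ : ∀ k → ℕ→ℚ k ≡ mkℚ (ℤ.+ k) 0 (Coprime.sym (Coprime.1-coprimeTo k))
ℕ→ℚ≡mkℚ k = ℚ.↥p/↧p≡p (mkℚ (ℤ.+ k) 0 (Coprime.sym (Coprime.1-coprimeTo k)))

ℕ→ℚ-suc : ∀ k → ℕ→ℚ (suc k) ≡ ℕ→ℚ k + 1ℚ
ℕ→ℚ-suc k rewrite ℕ→ℚ≡mkℚ k | ℕ→ℚ≡mkℚ (suc k) =
  ℚ.toℚᵘ-injective (ℚᵘ.≃-sym (ℚᵘ.≃-trans (ℚ.toℚᵘ-homo-+ (mkℚ (ℤ.+ k) 0 (Coprime.sym (Coprime.1-coprimeTo k))) 1ℚ) (ℚᵘ.*≡* cross-multiplied)))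
  where
  cross-multiplied : (ℤ.+ k ℤ.* ℤ.+ 1 ℤ.+ ℤ.+ 1) ℤ.* ℤ.+ 1 ≡ ℤ.+ suc k ℤ.* ℤ.+ 1
  cross-multiplied = cong (ℤ._* ℤ.+ 1) (trans (cong (ℤ._+ ℤ.+ 1) (ℤ.*-identityʳ (ℤ.+ k))) (ℤ.+-comm (ℤ.+ k) (ℤ.+ 1)))

÷'-by-inverse : ∀ a b c → b * c ≡ 1ℚ → a ÷' b ≡ a * c
÷'-by-inverse a b c bc≡1 with b ℚ.≟ 0ℚ
... | yes refl = ⊥-elim (ℚ.1≢0 (trans (sym bc≡1) (ℚ.*-zeroˡ c)))
... | no b≢0 = cong (a *_) (begin
  1/ b             ≡⟨ ℚ.*-identityʳ (1/ b) ⟨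
  1/ b * 1ℚ        ≡⟨ cong (1/ b *_) bc≡1 ⟨
  1/ b * (b * c)   ≡⟨ ℚ.*-assoc (1/ b) b c ⟨
  (1/ b * b) * c   ≡⟨ cong (_* c) (ℚ.*-inverseˡ b) ⟩
  1ℚ * c           ≡⟨ ℚ.*-identityˡ c ⟩
  c                ∎)
  where
  open ≡-Reasoning
  instance
    b-nonZero : ℚ.NonZero b
    b-nonZero = ℚ.≢-nonZero b≢0

*-÷'-inverse : ∀ b → b ≢ 0ℚ → b * (1ℚ ÷' b) ≡ 1ℚ
*-÷'-inverse b b≢0 with b ℚ.≟ 0ℚ
... | yes b≡0 = ⊥-elim (b≢0 b≡0)
... | no b≢0′ = trans (cong (b *_) (ℚ.*-identityˡ (1/ b))) (ℚ.*-inverseʳ b)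
  where
  instance
    b-nonZero : ℚ.NonZero b
    b-nonZero = ℚ.≢-nonZero b≢0′

[a-b]+[c-e]≡[a+c]-[b+e] : ∀ a b c e → (a - b) + (c - e) ≡ (a + c) - (b + e)
[a-b]+[c-e]≡[a+c]-[b+e] = solve 4 (λ a b c e → (a :- b) :+ (c :- e) := (a :+ c) :- (b :+ e)) refl

*-distribˡ-- : ∀ c a b → c * (a - b) ≡ c * a - c * b
*-distribˡ-- = solve 3 (λ c a b → c :* (a :- b) := c :* a :- c :* b) refl

*-distribʳ-- : ∀ c a b → (a - b) * c ≡ a * c - b * c
*-distribʳ-- = solve 3 (λ c a b → (a :- b) :* c := a :* c :- b :* c) refl

a-[a-b]≡b : ∀ a b → a - (a - b) ≡ b
a-[a-b]≡b = solve 2 (λ a b → a :- (a :- b) := b) refl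

a+b-a≡b : ∀ a b → a + b - a ≡ b
a+b-a≡b = solve 2 (λ a b → a :+ b :- a := b) refl


module _ {A : Set} where

  sumℚ-cong : ∀ (xs : List A) {f g : A → ℚ} → (∀ x → f x ≡ g x) → sumℚ xs f ≡ sumℚ xs g
  sumℚ-cong []       f≗g = refl
  sumℚ-cong (x ∷ xs) f≗g = cong₂ _+_ (f≗g x) (sumℚ-cong xs f≗g)

  sumℚ-++ : ∀ (xs ys : List A) (f : A → ℚ) → sumℚ (xs ++ ys) f ≡ sumℚ xs f + sumℚ ys f
  sumℚ-++ []       ys f = sym (ℚ.+-identityˡ _)
  sumℚ-++ (x ∷ xs) ys f = trans (cong (f x +_) (sumℚ-++ xs ys f)) (sym (ℚ.+-assoc (f x) _ _))

  sumℚ-zero : ∀ (xs : List A) → sumℚ xs (λ _ → 0ℚ) ≡ 0ℚ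
  sumℚ-zero []       = refl
  sumℚ-zero (x ∷ xs) = trans (ℚ.+-identityˡ _) (sumℚ-zero xs)

  sumℚ-+ : ∀ (xs : List A) (f g : A → ℚ) → sumℚ xs (λ x → f x + g x) ≡ sumℚ xs f + sumℚ xs g
  sumℚ-+ []       f g = refl
  sumℚ-+ (x ∷ xs) f g = trans (cong (f x + g x +_) (sumℚ-+ xs f g)) (ℚ+.interchange (f x) (g x) _ _)

  *-distribˡ-sumℚ : ∀ c (xs : List A) (f : A → ℚ) → c * sumℚ xs f ≡ sumℚ xs (λ x → c * f x)
  *-distribˡ-sumℚ c []       f = ℚ.*-zeroʳ c
  *-distribˡ-sumℚ c (x ∷ xs) f = trans (ℚ.*-distribˡ-+ c (f x) _) (cong (c * f x +_) (*-distribˡ-sumℚ c xs f))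

module _ {A B : Set} where

  sumℚ-map : ∀ (g : A → B) (xs : List A) (f : B → ℚ) → sumℚ (map g xs) f ≡ sumℚ xs (λ x → f (g x))
  sumℚ-map g []       f = refl
  sumℚ-map g (x ∷ xs) f = cong (f (g x) +_) (sumℚ-map g xs f)

  sumℚ-concatMap : ∀ (g : A → List B) (xs : List A) (f : B → ℚ) → sumℚ (concatMap g xs) f ≡ sumℚ xs (λ x → sumℚ (g x) f)
  sumℚ-concatMap g []       f = refl
  sumℚ-concatMap g (x ∷ xs) f =
    trans (sumℚ-++ (g x) (concatMap g xs) f) (cong (sumℚ (g x) f +_) (sumℚ-concatMap g xs f))

  sumℚ-comm : ∀ (xs : List A) (ys : List B) (f : A → B → ℚ) →
    sumℚ xs (λ x → sumℚ ys (f x)) ≡ sumℚ ys (λ y → sumℚ xs (λ x → f x y))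
  sumℚ-comm []       ys f = sym (sumℚ-zero ys)
  sumℚ-comm (x ∷ xs) ys f =
    trans (cong (sumℚ ys (f x) +_) (sumℚ-comm xs ys f)) (sym (sumℚ-+ ys (f x) (λ y → sumℚ xs (λ x → f x y))))

if-0ℚ-*ʳ : ∀ b c x → (if b then c * x else 0ℚ) ≡ c * (if b then x else 0ℚ)
if-0ℚ-*ʳ true  c x = refl
if-0ℚ-*ʳ false c x = sym (ℚ.*-zeroʳ c)

if-0ℚ-*-indicator : ∀ b c → (if b then c else 0ℚ) ≡ c * (if b then 1ℚ else 0ℚ)
if-0ℚ-*-indicator true  c = sym (ℚ.*-identityʳ c)
if-0ℚ-*-indicator false c = sym (ℚ.*-zeroʳ c)

if-∧ : ∀ a b (x : ℚ) → (if a then (if b then x else 0ℚ) else 0ℚ) ≡ (if a ∧ b then x else 0ℚ)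
if-∧ true  b x = refl
if-∧ false b x = refl

sumℚ-if : ∀ {A : Set} (xs : List A) b (f : A → ℚ) → sumℚ xs (λ x → if b then f x else 0ℚ) ≡ (if b then sumℚ xs f else 0ℚ)
sumℚ-if xs true  f = refl
sumℚ-if xs false f = sumℚ-zero xs

sumℚ-tabulate : ∀ {A : Set} k (f : Fin k → A) (φ : A → ℚ) → sumℚ (tabulate f) φ ≡ sumℚ (allFin k) (φ ∘ f)
sumℚ-tabulate zero    f φ = refl
sumℚ-tabulate (suc k) f φ =
  cong (φ (f zero) +_) (trans (sumℚ-tabulate k (f ∘ suc) φ) (sym (sumℚ-tabulate k suc (φ ∘ f))))

sumℚ-allFin-suc : ∀ k (φ : Fin (suc k) → ℚ) → sumℚ (allFin (suc k)) φ ≡ φ zero + sumℚ (allFin k) (φ ∘ suc)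
sumℚ-allFin-suc k φ = cong (φ zero +_) (sumℚ-tabulate k suc φ)

sumℚ-allFin-last : ∀ k (φ : Fin (suc k) → ℚ) →
  sumℚ (allFin (suc k)) φ ≡ sumℚ (allFin k) (φ ∘ inject₁) + φ (fromℕ k)
sumℚ-allFin-last zero    φ = trans (ℚ.+-identityʳ (φ zero)) (sym (ℚ.+-identityˡ (φ zero)))
sumℚ-allFin-last (suc k) φ = begin
  sumℚ (allFin (suc (suc k))) φ                                               ≡⟨ sumℚ-allFin-suc (suc k) φ ⟩
  φ zero + sumℚ (allFin (suc k)) (φ ∘ suc)                                    ≡⟨ cong (φ zero +_) (sumℚ-allFin-last k (φ ∘ suc)) ⟩
  φ zero + (sumℚ (allFin k) (φ ∘ suc ∘ inject₁) + φ (fromℕ (suc k)))          ≡⟨ ℚ.+-assoc (φ zero) _ _ ⟨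
  φ zero + sumℚ (allFin k) (φ ∘ inject₁ ∘ suc) + φ (fromℕ (suc k))            ≡⟨ cong (_+ φ (fromℕ (suc k))) (sumℚ-allFin-suc k (φ ∘ inject₁)) ⟨
  sumℚ (allFin (suc k)) (φ ∘ inject₁) + φ (fromℕ (suc k))                     ∎
  where open ≡-Reasoning

sumℚ-allVecs-suc : ∀ q n (φ : Vec (Fin q) (suc n) → ℚ) →
  sumℚ (allVecs q (suc n)) φ ≡ sumℚ (allFin q) (λ c → sumℚ (allVecs q n) (λ f → φ (c ∷ f)))
sumℚ-allVecs-suc q n φ =
  trans (sumℚ-concatMap _ (allFin q) φ) (sumℚ-cong (allFin q) (λ c → sumℚ-map (c ∷_) (allVecs q n) φ))

sumℚ-allVecs-1 : ∀ n (φ : Vec (Fin 1) n → ℚ) → sumℚ (allVecs 1 n) φ ≡ φ (Vec.replicate n zero)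
sumℚ-allVecs-1 zero    φ = ℚ.+-identityʳ _
sumℚ-allVecs-1 (suc n) φ =
  trans (sumℚ-allVecs-suc 1 n φ) (trans (ℚ.+-identityʳ _) (sumℚ-allVecs-1 n (λ f → φ (zero ∷ f))))

T-not⇒¬T : ∀ {b} → T (not b) → ¬ T b
T-not⇒¬T {false} _ ()

¬T⇒T-not : ∀ {b} → ¬ T b → T (not b)
¬T⇒T-not {false} _  = tt
¬T⇒T-not {true}  ¬t = ⊥-elim (¬t tt)

dec-true⁻ : ∀ {A : Set} (a? : Dec A) → does a? ≡ true → A
dec-true⁻ (yes a) _ = a

allB-cong : ∀ {A : Set} (xs : List A) {p q : A → Bool} → (∀ x → p x ≡ q x) → allB p xs ≡ allB q xs
allB-cong []       p≗q = refl
allB-cong (x ∷ xs) p≗q rewrite p≗q x | allB-cong xs p≗q = refl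

allB-tabulate : ∀ {A : Set} k (f : Fin k → A) (p : A → Bool) → allB p (tabulate f) ≡ allB (p ∘ f) (allFin k)
allB-tabulate zero    f p = refl
allB-tabulate (suc k) f p with p (f zero)
... | true  = trans (allB-tabulate k (f ∘ suc) p) (sym (allB-tabulate k suc (p ∘ f)))
... | false = refl

allB-allFin-suc : ∀ k (p : Fin (suc k) → Bool) →
  allB p (allFin (suc k)) ≡ (if p zero then allB (p ∘ suc) (allFin k) else false)
allB-allFin-suc k p with p zero
... | true  = allB-tabulate k suc p
... | false = refl

allB-allFin⁻ : ∀ k (p : Fin k → Bool) → T (allB p (allFin k)) → ∀ x → T (p x)
allB-allFin⁻ (suc k) p all-p x with p zero in p0 | x
... | true | zero  = subst T (sym p0) tt
... | true | suc y = allB-allFin⁻ k (p ∘ suc) (subst T (allB-tabulate k suc p) all-p) y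

allB-allFin⁺ : ∀ k (p : Fin k → Bool) → (∀ x → T (p x)) → T (allB p (allFin k))
allB-allFin⁺ zero    p all-p = tt
allB-allFin⁺ (suc k) p all-p with p zero | all-p zero
... | true | _ = subst T (sym (allB-tabulate k suc p)) (allB-allFin⁺ k (p ∘ suc) (all-p ∘ suc))

count-tabulate : ∀ {A : Set} k (f : Fin k → A) (p : A → Bool) → count (tabulate f) p ≡ count (allFin k) (p ∘ f)
count-tabulate zero    f p = refl
count-tabulate (suc k) f p with p (f zero)
... | true  = cong suc (trans (count-tabulate k (f ∘ suc) p) (sym (count-tabulate k suc (p ∘ f))))
... | false = trans (count-tabulate k (f ∘ suc) p) (sym (count-tabulate k suc (p ∘ f)))

count-allFin-suc : ∀ k (p : Fin (suc k) → Bool) →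
  count (allFin (suc k)) p ≡ (if p zero then suc (count (allFin k) (p ∘ suc)) else count (allFin k) (p ∘ suc))
count-allFin-suc k p with p zero
... | true  = cong suc (count-tabulate k suc p)
... | false = count-tabulate k suc p

indicator : Bool → ℕ
indicator true  = 1
indicator false = 0

count-allFin-suc-indicator : ∀ k (p : Fin (suc k) → Bool) → count (allFin (suc k)) p ≡ indicator (p zero) ℕ.+ count (allFin k) (p ∘ suc)
count-allFin-suc-indicator k p with p zero | count-allFin-suc k p
... | true  | eq = eq
... | false | eq = eq

count-cong : ∀ k {p q : Fin k → Bool} → (∀ x → p x ≡ q x) → count (allFin k) p ≡ count (allFin k) q
count-cong zero    p≗q = refl
count-cong (suc k) {p} {q} p≗q = begin
  count (allFin (suc k)) p                          ≡⟨ count-allFin-suc-indicator k p ⟩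
  indicator (p zero) ℕ.+ count (allFin k) (p ∘ suc) ≡⟨ cong₂ ℕ._+_ (cong indicator (p≗q zero)) (count-cong k (p≗q ∘ suc)) ⟩
  indicator (q zero) ℕ.+ count (allFin k) (q ∘ suc) ≡⟨ count-allFin-suc-indicator k q ⟨
  count (allFin (suc k)) q                          ∎
  where open ≡-Reasoning

count-mono : ∀ k {p q : Fin k → Bool} → (∀ x → T (p x) → T (q x)) → count (allFin k) p ≤ count (allFin k) q
count-mono zero    p⇒q = z≤n
count-mono (suc k) {p} {q} p⇒q rewrite count-allFin-suc-indicator k p | count-allFin-suc-indicator k q =
  ℕ.+-mono-≤ (indicator-mono (p zero) (q zero) (p⇒q zero)) (count-mono k (p⇒q ∘ suc))
  where
  indicator-mono : ∀ a b → (T a → T b) → indicator a ≤ indicator b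
  indicator-mono false b     _   = z≤n
  indicator-mono true  true  _   = ℕ.≤-refl
  indicator-mono true  false a⇒b = ⊥-elim (a⇒b tt)

count-split : ∀ k (p r : Fin k → Bool) →
  count (allFin k) p ≡ count (allFin k) (λ x → p x ∧ r x) ℕ.+ count (allFin k) (λ x → p x ∧ not (r x))
count-split zero    p r = refl
count-split (suc k) p r
  rewrite count-allFin-suc-indicator k p | count-allFin-suc-indicator k (λ x → p x ∧ r x) | count-allFin-suc-indicator k (λ x → p x ∧ not (r x))
        | count-split k (p ∘ suc) (r ∘ suc) = shuffle (p zero) (r zero) _ _
  where
  shuffle : ∀ a b x y → indicator a ℕ.+ (x ℕ.+ y) ≡ (indicator (a ∧ b) ℕ.+ x) ℕ.+ (indicator (a ∧ not b) ℕ.+ y)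
  shuffle false b     x y = refl
  shuffle true  true  x y = refl
  shuffle true  false x y = sym (ℕ.+-suc x y)

count-true : ∀ k → count (allFin k) (λ _ → true) ≡ k
count-true zero    = refl
count-true (suc k) = trans (count-allFin-suc-indicator k (λ _ → true)) (cong suc (count-true k))

1≤count : ∀ k (p : Fin k → Bool) x → T (p x) → 1 ≤ count (allFin k) p
1≤count (suc k) p zero    px rewrite count-allFin-suc-indicator k p with p zero
... | true = s≤s z≤n
1≤count (suc k) p (suc x) px rewrite count-allFin-suc-indicator k p =
  ℕ.≤-trans (1≤count k (p ∘ suc) x px) (ℕ.m≤n+m _ (indicator (p zero)))

count≤1 : ∀ k (p : Fin k → Bool) → (∀ x y → T (p x) → T (p y) → x ≡ y) → count (allFin k) p ≤ 1
count≤1 zero    p unique = z≤n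
count≤1 (suc k) p unique rewrite count-allFin-suc-indicator k p with p zero in p0
... | false = count≤1 k (p ∘ suc) (λ x y px py → Fin.suc-injective (unique (suc x) (suc y) px py))
... | true  = s≤s (ℕ.≤-reflexive (trans (count-cong k (λ x → ≡false (λ px → 0≢suc (unique zero (suc x) (Equivalence.from T-≡ p0) px))))
                                          (count-false k)))
  where
  0≢suc : ∀ {x : Fin k} → zero ≢ suc x
  0≢suc ()
  ≡false : ∀ {b} → ¬ T b → b ≡ false
  ≡false {false} _  = refl
  ≡false {true}  ¬b = ⊥-elim (¬b tt)
  count-false : ∀ j → count (allFin j) (λ _ → false) ≡ 0
  count-false zero    = refl
  count-false (suc j) = trans (count-allFin-suc-indicator j (λ _ → false)) (count-false j)

count≡sum : ∀ k (p : Fin k → Bool) → count (allFin k) p ≡ sum (indicator ∘ p)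
count≡sum zero    p = refl
count≡sum (suc k) p = trans (count-allFin-suc-indicator k p) (cong (indicator (p zero) ℕ.+_) (count≡sum k (p ∘ suc)))

count-involution : ∀ k (π : Fin k → Fin k) → (∀ x → π (π x) ≡ x) → (p : Fin k → Bool) →
  count (allFin k) (p ∘ π) ≡ count (allFin k) p
count-involution k π involutive p = begin
  count (allFin k) (p ∘ π)  ≡⟨ count≡sum k (p ∘ π) ⟩
  sum (indicator ∘ p ∘ π)   ≡⟨ sum-permute (indicator ∘ p) (Permutation.permutation π π involutive involutive) ⟨
  sum (indicator ∘ p)       ≡⟨ count≡sum k p ⟨
  count (allFin k) p        ∎
  where open ≡-Reasoning


∈⇒lookup : ∀ {k} {W : Subset k} {v} → v ∈ W → lookup W v ≡ true
∈⇒lookup = Vec.[]=⇒lookup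

lookup⇒∈ : ∀ {k} {W : Subset k} {v} → lookup W v ≡ true → v ∈ W
lookup⇒∈ {W = W} {v} = Vec.lookup⇒[]= v W

∉⇒lookup : ∀ {k} {W : Subset k} {v} → v ∉ W → lookup W v ≡ false
∉⇒lookup {W = W} {v} v∉W with lookup W v in Wv
... | true  = contradiction (lookup⇒∈ Wv) v∉W
... | false = refl

lookup-─ : ∀ {k} (W U : Subset k) v → lookup (W ─ U) v ≡ (if lookup U v then false else lookup W v)
lookup-─ (w ∷ W) (true  ∷ U) zero    = refl
lookup-─ (w ∷ W) (false ∷ U) zero    = refl
lookup-─ (w ∷ W) (u ∷ U)     (suc v) = lookup-─ W U v

∣∁p∣≡count : ∀ k (S : Subset k) → ∣ ∁ S ∣ ≡ count (allFin k) (λ a → not (lookup S a))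
∣∁p∣≡count zero    []      = refl
∣∁p∣≡count (suc k) (b ∷ S) rewrite count-allFin-suc-indicator k (λ a → not (lookup (b ∷ S) a)) | ∣∁p∣≡count k S with b
... | true  = refl
... | false = refl

∣p─q∣+∣q∣≡∣p∣ : ∀ {n} (p q : Subset n) → q ⊆ p → ∣ p ─ q ∣ ℕ.+ ∣ q ∣ ≡ ∣ p ∣
∣p─q∣+∣q∣≡∣p∣ []            []            _   = refl
∣p─q∣+∣q∣≡∣p∣ (x ∷ p)       (inside ∷ q)  q⊆p with q⊆p here
... | here = trans (ℕ.+-suc ∣ p ─ q ∣ ∣ q ∣) (cong suc (∣p─q∣+∣q∣≡∣p∣ p q (drop-∷-⊆ q⊆p)))
∣p─q∣+∣q∣≡∣p∣ (inside ∷ p)  (outside ∷ q) q⊆p = cong suc (∣p─q∣+∣q∣≡∣p∣ p q (drop-∷-⊆ q⊆p))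
∣p─q∣+∣q∣≡∣p∣ (outside ∷ p) (outside ∷ q) q⊆p = ∣p─q∣+∣q∣≡∣p∣ p q (drop-∷-⊆ q⊆p)

∣p∣≡1+d⇒Nonempty : ∀ {k d} (W : Subset k) → ∣ W ∣ ≡ suc d → Nonempty W
∣p∣≡1+d⇒Nonempty {k} W ∣W∣≡1+d with nonempty? W
... | yes W≢∅ = W≢∅
... | no  W≡∅ = contradiction (trans (sym ∣W∣≡1+d) (trans (cong ∣_∣ (Empty-unique W≡∅)) (∣⊥∣≡0 k))) ℕ.1+n≢0

Nonempty-outside∷⇔ : ∀ {n} {U : Subset n} → Nonempty (outside ∷ U) ⇔ Nonempty U
Nonempty-outside∷⇔ = mk⇔ (λ { (suc x , there x∈U) → x , x∈U }) (λ { (x , x∈U) → suc x , there x∈U })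

sumℚ-allSubsets-suc : ∀ n (φ : Subset (suc n) → ℚ) →
  sumℚ (allSubsets (suc n)) φ ≡ sumℚ (allSubsets n) (λ U → φ (inside ∷ U)) + sumℚ (allSubsets n) (λ U → φ (outside ∷ U))
sumℚ-allSubsets-suc n φ =
  trans (sumℚ-concatMap (λ b → map (b ∷_) (allSubsets n)) (inside ∷ outside ∷ []) φ)
    (cong₂ _+_ (sumℚ-map (inside ∷_) (allSubsets n) φ)
               (trans (ℚ.+-identityʳ _) (sumℚ-map (outside ∷_) (allSubsets n) φ)))

sumℚ-allSubsets-∅ : ∀ n (φ : Subset n → ℚ) →
  sumℚ (allSubsets n) φ ≡ φ ∅ + sumℚ (allSubsets n) (λ U → if does (nonempty? U) then φ U else 0ℚ)
sumℚ-allSubsets-∅ zero    φ = refl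
sumℚ-allSubsets-∅ (suc n) φ = begin
  sumℚ (allSubsets (suc n)) φ
    ≡⟨ sumℚ-allSubsets-suc n φ ⟩
  X + sumℚ (allSubsets n) (λ U → φ (outside ∷ U))
    ≡⟨ cong (X +_) (sumℚ-allSubsets-∅ n (λ U → φ (outside ∷ U))) ⟩
  X + (φ ∅ + Y)
    ≡⟨ ℚ+.x∙yz≈y∙xz X (φ ∅) Y ⟩
  φ ∅ + (X + Y)
    ≡⟨ cong (λ Z → φ ∅ + (X + Z)) (sumℚ-cong (allSubsets n) (λ U →
         cong (λ b → if b then φ (outside ∷ U) else 0ℚ) (sym (does-⇔ Nonempty-outside∷⇔ (nonempty? (outside ∷ U)) (nonempty? U))))) ⟩
  φ ∅ + (X + sumℚ (allSubsets n) (λ U → if does (nonempty? (outside ∷ U)) then φ (outside ∷ U) else 0ℚ))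
    ≡⟨ cong (φ ∅ +_) (sumℚ-allSubsets-suc n (λ U → if does (nonempty? U) then φ U else 0ℚ)) ⟨
  φ ∅ + sumℚ (allSubsets (suc n)) (λ U → if does (nonempty? U) then φ U else 0ℚ)
    ∎
  where
  open ≡-Reasoning
  X Y : ℚ
  X = sumℚ (allSubsets n) (λ U → φ (inside ∷ U))
  Y = sumℚ (allSubsets n) (λ U → if does (nonempty? U) then φ (outside ∷ U) else 0ℚ)

-- The terms U and U ∪ {x}, for a fixed x ∈ K, cancel.
alternating-sum-⊆ : ∀ {n} (K : Subset n) → Nonempty K →
  sumℚ (allSubsets n) (λ U → if does (U ⊆? K) then (- 1ℚ) ^ ∣ U ∣ else 0ℚ) ≡ 0ℚ
alternating-sum-⊆ {suc n} (inside ∷ K) _ = begin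
  sumℚ (allSubsets (suc n)) (λ U → if does (U ⊆? inside ∷ K) then (- 1ℚ) ^ ∣ U ∣ else 0ℚ)
    ≡⟨ sumℚ-allSubsets-suc n _ ⟩
  sumℚ (allSubsets n) (λ U → if does (U ⊆? K) then - 1ℚ * (- 1ℚ) ^ ∣ U ∣ else 0ℚ) + X
    ≡⟨ cong (_+ X) (sumℚ-cong (allSubsets n) (λ U → if-0ℚ-*ʳ (does (U ⊆? K)) (- 1ℚ) _)) ⟩
  sumℚ (allSubsets n) (λ U → - 1ℚ * (if does (U ⊆? K) then (- 1ℚ) ^ ∣ U ∣ else 0ℚ)) + X
    ≡⟨ cong (_+ X) (*-distribˡ-sumℚ (- 1ℚ) (allSubsets n) _) ⟨
  - 1ℚ * X + X
    ≡⟨ cong (_+ X) (trans (sym (ℚ.neg-distribˡ-* 1ℚ X)) (cong -_ (ℚ.*-identityˡ X))) ⟩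
  - X + X
    ≡⟨ ℚ.+-inverseˡ X ⟩
  0ℚ ∎
  where
  open ≡-Reasoning
  X : ℚ
  X = sumℚ (allSubsets n) (λ U → if does (U ⊆? K) then (- 1ℚ) ^ ∣ U ∣ else 0ℚ)
alternating-sum-⊆ {suc n} (outside ∷ K) (suc x , there x∈K) = begin
  sumℚ (allSubsets (suc n)) (λ U → if does (U ⊆? outside ∷ K) then (- 1ℚ) ^ ∣ U ∣ else 0ℚ)
    ≡⟨ sumℚ-allSubsets-suc n _ ⟩
  sumℚ (allSubsets n) (λ _ → 0ℚ) + sumℚ (allSubsets n) (λ U → if does (U ⊆? K) then (- 1ℚ) ^ ∣ U ∣ else 0ℚ)
    ≡⟨ cong₂ _+_ (sumℚ-zero (allSubsets n)) (alternating-sum-⊆ K (x , x∈K)) ⟩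
  0ℚ ∎
  where open ≡-Reasoning

alternating-sum-nonempty-⊆ : ∀ {n} (K : Subset n) → Nonempty K →
  sumℚ (allSubsets n) (λ U → if does (nonempty? U) ∧ does (U ⊆? K) then (- 1ℚ) ^ ∣ U ∣ else 0ℚ) ≡ - 1ℚ
alternating-sum-nonempty-⊆ {n} K K≢∅ = begin
  sumℚ (allSubsets n) (λ U → if does (nonempty? U) ∧ does (U ⊆? K) then (- 1ℚ) ^ ∣ U ∣ else 0ℚ)
    ≡⟨ sumℚ-cong (allSubsets n) (λ U → if-∧ (does (nonempty? U)) (does (U ⊆? K)) _) ⟨
  X
    ≡⟨ ℚ.+-identityˡ X ⟨
  0ℚ + X
    ≡⟨ cong (_+ X) (ℚ.+-inverseʳ 1ℚ) ⟨
  1ℚ - 1ℚ + X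
    ≡⟨ ℚ+.xy∙z≈y∙xz 1ℚ (- 1ℚ) X ⟩
  - 1ℚ + (1ℚ + X)
    ≡⟨ cong (λ e → - 1ℚ + (e + X)) φ∅≡1 ⟨
  - 1ℚ + (φ ∅ + X)
    ≡⟨ cong (- 1ℚ +_) (trans (sumℚ-allSubsets-∅ n φ) (cong (φ ∅ +_) (sumℚ-cong (allSubsets n) (λ _ → refl)))) ⟨
  - 1ℚ + sumℚ (allSubsets n) φ
    ≡⟨ cong (- 1ℚ +_) (alternating-sum-⊆ K K≢∅) ⟩
  - 1ℚ + 0ℚ
    ≡⟨ ℚ.+-identityʳ (- 1ℚ) ⟩
  - 1ℚ ∎
  where
  open ≡-Reasoning
  φ : Subset n → ℚ
  φ U = if does (U ⊆? K) then (- 1ℚ) ^ ∣ U ∣ else 0ℚ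
  X : ℚ
  X = sumℚ (allSubsets n) (λ U → if does (nonempty? U) then φ U else 0ℚ)
  φ∅≡1 : φ ∅ ≡ 1ℚ
  φ∅≡1 = trans (cong (if_then (- 1ℚ) ^ ∣ ∅ {n} ∣ else 0ℚ) (dec-true (∅ {n} ⊆? K) ⊥⊆)) (cong ((- 1ℚ) ^_) (∣⊥∣≡0 n))

-- Expanding each factor 1 + t of (1 + t)^#{a | p a} chooses the arcs outside S.
binomial-subsets : ∀ t k (p : Fin k → Bool) →
  (1ℚ + t) ^ count (allFin k) p ≡
  sumℚ (allSubsets k) (λ S → if allB (λ a → lookup S a ∨ p a) (allFin k) then t ^ ∣ ∁ S ∣ else 0ℚ)
binomial-subsets t zero    p = sym (ℚ.+-identityʳ 1ℚ)
binomial-subsets t (suc k) p = begin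
  (1ℚ + t) ^ count (allFin (suc k)) p
    ≡⟨ cong ((1ℚ + t) ^_) (count-allFin-suc k p) ⟩
  (1ℚ + t) ^ (if p zero then suc c else c)
    ≡⟨ split (p zero) ⟩
  R + sumℚ (allSubsets k) (λ S → if (if p zero then accepts S else false) then t ^ suc ∣ ∁ S ∣ else 0ℚ)
    ≡⟨ cong₂ _+_ (sumℚ-cong (allSubsets k) (λ S → cong (if_then t ^ ∣ ∁ S ∣ else 0ℚ) (sym (allB-allFin-suc k (λ a → lookup (inside ∷ S) a ∨ p a)))))
                 (sumℚ-cong (allSubsets k) (λ S → cong (if_then t ^ suc ∣ ∁ S ∣ else 0ℚ) (sym (allB-allFin-suc k (λ a → lookup (outside ∷ S) a ∨ p a))))) ⟩
  sumℚ (allSubsets k) (λ S → term (inside ∷ S)) + sumℚ (allSubsets k) (λ S → term (outside ∷ S))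
    ≡⟨ sumℚ-allSubsets-suc k term ⟨
  sumℚ (allSubsets (suc k)) term ∎
  where
  open ≡-Reasoning
  term : Subset (suc k) → ℚ
  term S = if allB (λ a → lookup S a ∨ p a) (allFin (suc k)) then t ^ ∣ ∁ S ∣ else 0ℚ
  c : ℕ
  c = count (allFin k) (p ∘ suc)
  accepts : Subset k → Bool
  accepts S = allB (λ a → lookup S a ∨ p (suc a)) (allFin k)
  R : ℚ
  R = sumℚ (allSubsets k) (λ S → if accepts S then t ^ ∣ ∁ S ∣ else 0ℚ)
  split : ∀ b → (1ℚ + t) ^ (if b then suc c else c) ≡
    R + sumℚ (allSubsets k) (λ S → if (if b then accepts S else false) then t ^ suc ∣ ∁ S ∣ else 0ℚ)
  split false = trans (binomial-subsets t k (p ∘ suc)) (sym (trans (cong (R +_) (sumℚ-zero (allSubsets k))) (ℚ.+-identityʳ R)))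
  split true  = begin
    (1ℚ + t) * (1ℚ + t) ^ c                                             ≡⟨ cong ((1ℚ + t) *_) (binomial-subsets t k (p ∘ suc)) ⟩
    (1ℚ + t) * R                                                        ≡⟨ ℚ.*-distribʳ-+ R 1ℚ t ⟩
    1ℚ * R + t * R                                                      ≡⟨ cong₂ _+_ (ℚ.*-identityˡ R) (*-distribˡ-sumℚ t (allSubsets k) _) ⟩
    R + sumℚ (allSubsets k) (λ S → t * (if accepts S then t ^ ∣ ∁ S ∣ else 0ℚ))
      ≡⟨ cong (R +_) (sumℚ-cong (allSubsets k) (λ S → sym (if-0ℚ-*ʳ (accepts S) t (t ^ ∣ ∁ S ∣)))) ⟩
    R + sumℚ (allSubsets k) (λ S → if accepts S then t ^ suc ∣ ∁ S ∣ else 0ℚ) ∎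


Δ : (ℕ → ℚ) → ℕ → ℚ
Δ g k = g (suc k) - g k

Δ-suc : ∀ g k → g (suc k) ≡ g k + Δ g k
Δ-suc g k = solve 2 (λ a b → a := b :+ (a :- b)) refl (g (suc k)) (g k)

-- g is a sequence of degree ≤ d whose polynomial interpolant takes the value v at −1;
-- the recursion reads that value off as g 0 − (Δ g)(−1).
ExtrapolatesTo : ℕ → (ℕ → ℚ) → ℚ → Set
ExtrapolatesTo zero    g v = ∀ k → g k ≡ v
ExtrapolatesTo (suc d) g v = Σ ℚ λ w → ExtrapolatesTo d (Δ g) w × g 0 - w ≡ v

ExtrapolatesTo-resp : ∀ d {g h v} → (∀ k → g k ≡ h k) → ExtrapolatesTo d g v → ExtrapolatesTo d h v
ExtrapolatesTo-resp zero    g≗h g→v k = trans (sym (g≗h k)) (g→v k)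
ExtrapolatesTo-resp (suc d) g≗h (w , Δg→w , eq) =
  w , ExtrapolatesTo-resp d (λ k → cong₂ _-_ (g≗h (suc k)) (g≗h k)) Δg→w , trans (cong (_- w) (sym (g≗h 0))) eq

ExtrapolatesTo-suc : ∀ d {g v} → ExtrapolatesTo d g v → ExtrapolatesTo (suc d) g v
ExtrapolatesTo-suc zero {g} {v} g→v =
  0ℚ , (λ k → trans (cong₂ _-_ (g→v (suc k)) (g→v k)) (ℚ.+-inverseʳ v)) , trans (ℚ.+-identityʳ (g 0)) (g→v 0)
ExtrapolatesTo-suc (suc d) (w , Δg→w , eq) = w , ExtrapolatesTo-suc d Δg→w , eq

ExtrapolatesTo-mono : ∀ {d d′} → d ℕ.≤ d′ → ∀ {g v} → ExtrapolatesTo d g v → ExtrapolatesTo d′ g v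
ExtrapolatesTo-mono {d′ = zero}  z≤n g→v = g→v
ExtrapolatesTo-mono {d′ = suc d} z≤n g→v = ExtrapolatesTo-suc d (ExtrapolatesTo-mono z≤n g→v)
ExtrapolatesTo-mono (s≤s d≤d′) (w , Δg→w , eq) = w , ExtrapolatesTo-mono d≤d′ Δg→w , eq

ExtrapolatesTo-+ : ∀ d {g h v w} → ExtrapolatesTo d g v → ExtrapolatesTo d h w →
  ExtrapolatesTo d (λ k → g k + h k) (v + w)
ExtrapolatesTo-+ zero    g→v h→w k = cong₂ _+_ (g→v k) (h→w k)
ExtrapolatesTo-+ (suc d) {g} {h} (v′ , Δg→v′ , eqg) (w′ , Δh→w′ , eqh) =
  v′ + w′ ,
  ExtrapolatesTo-resp d (λ k → [a-b]+[c-e]≡[a+c]-[b+e] (g (suc k)) (g k) (h (suc k)) (h k)) (ExtrapolatesTo-+ d Δg→v′ Δh→w′) ,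
  trans (sym ([a-b]+[c-e]≡[a+c]-[b+e] (g 0) v′ (h 0) w′)) (cong₂ _+_ eqg eqh)

ExtrapolatesTo-* : ∀ d c {g v} → ExtrapolatesTo d g v → ExtrapolatesTo d (λ k → c * g k) (c * v)
ExtrapolatesTo-* zero    c g→v k = cong (c *_) (g→v k)
ExtrapolatesTo-* (suc d) c {g} (w , Δg→w , eq) =
  c * w ,
  ExtrapolatesTo-resp d (λ k → *-distribˡ-- c (g (suc k)) (g k)) (ExtrapolatesTo-* d c Δg→w) ,
  trans (sym (*-distribˡ-- c (g 0) w)) (cong (c *_) eq)

ExtrapolatesTo-0 : ∀ d → ExtrapolatesTo d (λ _ → 0ℚ) 0ℚ
ExtrapolatesTo-0 zero    k = refl
ExtrapolatesTo-0 (suc d) = 0ℚ , ExtrapolatesTo-0 d , refl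

ExtrapolatesTo-sumℚ : ∀ d {A : Set} (xs : List A) {g : A → ℕ → ℚ} {v : A → ℚ} →
  (∀ x → ExtrapolatesTo d (g x) (v x)) → ExtrapolatesTo d (λ k → sumℚ xs (λ x → g x k)) (sumℚ xs v)
ExtrapolatesTo-sumℚ d []       g→v = ExtrapolatesTo-0 d
ExtrapolatesTo-sumℚ d (x ∷ xs) g→v = ExtrapolatesTo-+ d (g→v x) (ExtrapolatesTo-sumℚ d xs g→v)

ExtrapolatesTo-shift : ∀ d {g v} → ExtrapolatesTo d g v → ExtrapolatesTo d (λ k → g (suc k)) (g 0)
ExtrapolatesTo-shift zero    g→v k = trans (g→v (suc k)) (sym (g→v 0))
ExtrapolatesTo-shift (suc d) {g} (w , Δg→w , eq) =
  Δ g 0 , ExtrapolatesTo-shift d Δg→w , a-[a-b]≡b (g 1) (g 0)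

ExtrapolatesTo-unique : ∀ d {g h v w} → ExtrapolatesTo d g v → ExtrapolatesTo d h w → (∀ k → g k ≡ h k) → v ≡ w
ExtrapolatesTo-unique zero    g→v h→w g≗h = trans (sym (g→v 0)) (trans (g≗h 0) (h→w 0))
ExtrapolatesTo-unique (suc d) (v′ , Δg→v′ , eqg) (w′ , Δh→w′ , eqh) g≗h =
  trans (sym eqg)
    (trans (cong₂ _-_ (g≗h 0) (ExtrapolatesTo-unique d Δg→v′ Δh→w′ (λ k → cong₂ _-_ (g≗h (suc k)) (g≗h k)))) eqh)

-- By uniqueness applied to the shifted sequences, they also agree at 0.
ExtrapolatesTo-unique-suc : ∀ d {g h v w} → ExtrapolatesTo d g v → ExtrapolatesTo d h w →
  (∀ k → g (suc k) ≡ h (suc k)) → v ≡ w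
ExtrapolatesTo-unique-suc d {g} {h} g→v h→w g≗h = ExtrapolatesTo-unique d g→v h→w agree
  where
  agree : ∀ k → g k ≡ h k
  agree zero    = ExtrapolatesTo-unique d (ExtrapolatesTo-shift d g→v) (ExtrapolatesTo-shift d h→w) g≗h
  agree (suc k) = g≗h k

Δℚ : (ℚ → ℚ) → ℚ → ℚ
Δℚ p x = p (x + 1ℚ) - p x

IsPolynomial : ℕ → (ℚ → ℚ) → Set
IsPolynomial zero    p = ∀ a b → p a ≡ p b
IsPolynomial (suc d) p = IsPolynomial d (Δℚ p)

IsPolynomial-resp : ∀ d {p q} → (∀ x → p x ≡ q x) → IsPolynomial d p → IsPolynomial d q
IsPolynomial-resp zero    p≗q p-const a b = trans (sym (p≗q a)) (trans (p-const a b) (p≗q b))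
IsPolynomial-resp (suc d) p≗q p-poly = IsPolynomial-resp d (λ a → cong₂ _-_ (p≗q (a + 1ℚ)) (p≗q a)) p-poly

IsPolynomial-suc : ∀ d {p} → IsPolynomial d p → IsPolynomial (suc d) p
IsPolynomial-suc zero    p-const a b = cong₂ _-_ (p-const (a + 1ℚ) (b + 1ℚ)) (p-const a b)
IsPolynomial-suc (suc d) p-poly      = IsPolynomial-suc d p-poly

IsPolynomial-mono : ∀ {d d′} → d ℕ.≤ d′ → ∀ {p} → IsPolynomial d p → IsPolynomial d′ p
IsPolynomial-mono {d′ = zero}  z≤n p-poly = p-poly
IsPolynomial-mono {d′ = suc d} z≤n {p} p-poly = IsPolynomial-suc d (IsPolynomial-mono {d′ = d} z≤n {p} p-poly)
IsPolynomial-mono (s≤s d≤d′) p-poly = IsPolynomial-mono d≤d′ p-poly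

IsPolynomial-+ : ∀ d {p q} → IsPolynomial d p → IsPolynomial d q → IsPolynomial d (λ x → p x + q x)
IsPolynomial-+ zero    p-poly q-poly a b = cong₂ _+_ (p-poly a b) (q-poly a b)
IsPolynomial-+ (suc d) {p} {q} p-poly q-poly =
  IsPolynomial-resp d (λ a → [a-b]+[c-e]≡[a+c]-[b+e] (p (a + 1ℚ)) (p a) (q (a + 1ℚ)) (q a)) (IsPolynomial-+ d p-poly q-poly)

IsPolynomial-*ʳ : ∀ d c {p} → IsPolynomial d p → IsPolynomial d (λ x → p x * c)
IsPolynomial-*ʳ zero    c p-const a b = cong (_* c) (p-const a b)
IsPolynomial-*ʳ (suc d) c {p} p-poly =
  IsPolynomial-resp d (λ a → *-distribʳ-- c (p (a + 1ℚ)) (p a)) (IsPolynomial-*ʳ d c p-poly)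

IsPolynomial-shift : ∀ d {p} → IsPolynomial d p → IsPolynomial d (λ x → p (x + 1ℚ))
IsPolynomial-shift zero    p-const a b = p-const (a + 1ℚ) (b + 1ℚ)
IsPolynomial-shift (suc d) p-poly      = IsPolynomial-shift d p-poly

-- Product rule: Δ (x · p) = x · Δp + p (x + 1).
IsPolynomial-x* : ∀ d {p} → IsPolynomial d p → IsPolynomial (suc d) (λ x → x * p x)
IsPolynomial-x* zero {p} p-const a b = trans (Δ[x*c] a) (sym (Δ[x*c] b))
  where
  Δ[x*c] : ∀ a → (a + 1ℚ) * p (a + 1ℚ) - a * p a ≡ p 0ℚ
  Δ[x*c] a rewrite p-const (a + 1ℚ) 0ℚ | p-const a 0ℚ =
    solve 2 (λ a c → (a :+ con 1ℚ) :* c :- a :* c := c) refl a (p 0ℚ)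
IsPolynomial-x* (suc d) {p} p-poly =
  IsPolynomial-resp (suc d) product-rule
    (IsPolynomial-+ (suc d) {λ a → a * Δℚ p a} {λ a → p (a + 1ℚ)} (IsPolynomial-x* d p-poly) (IsPolynomial-shift (suc d) {p} p-poly))
  where
  product-rule : ∀ a → a * Δℚ p a + p (a + 1ℚ) ≡ (a + 1ℚ) * p (a + 1ℚ) - a * p a
  product-rule a = solve 3 (λ a u v → a :* (u :- v) :+ u := (a :+ con 1ℚ) :* u :- a :* v) refl a (p (a + 1ℚ)) (p a)

IsPolynomial-^ : ∀ i → IsPolynomial i (_^ i)
IsPolynomial-^ zero    a b = refl
IsPolynomial-^ (suc i) = IsPolynomial-x* i (IsPolynomial-^ i)

IsPolynomial⇒ExtrapolatesTo : ∀ d {p} → IsPolynomial d p → ExtrapolatesTo d (λ k → p (ℕ→ℚ k)) (p (- 1ℚ))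
IsPolynomial⇒ExtrapolatesTo zero    p-const k = p-const _ _
IsPolynomial⇒ExtrapolatesTo (suc d) {p} p-poly =
  Δℚ p (- 1ℚ) ,
  ExtrapolatesTo-resp d (λ k → cong (λ x → p x - p (ℕ→ℚ k)) (sym (ℕ→ℚ-suc k))) (IsPolynomial⇒ExtrapolatesTo d p-poly) ,
  a-[a-b]≡b (p 0ℚ) (p (- 1ℚ))

qDegree : Poly3 → ℕ
qDegree []                    = 0
qDegree ((c , i , j , k) ∷ P) = i ℕ.+ qDegree P

eval3-isPolynomial : ∀ P y z → IsPolynomial (qDegree P) (λ q → eval3 P q y z)
eval3-isPolynomial []                    y z = λ a b → refl
eval3-isPolynomial ((c , i , j , k) ∷ P) y z =
  IsPolynomial-+ (i ℕ.+ qDegree P) {λ q → c * ((q ^ i) * ((y ^ j) * (z ^ k)))} {λ q → eval3 P q y z}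
    (IsPolynomial-resp (i ℕ.+ qDegree P) (λ q → ℚ.*-comm _ c)
      (IsPolynomial-mono (ℕ.m≤m+n i (qDegree P)) (IsPolynomial-*ʳ i c (IsPolynomial-*ʳ i ((y ^ j) * (z ^ k)) (IsPolynomial-^ i)))))
    (IsPolynomial-mono (ℕ.m≤n+m (qDegree P) i) (eval3-isPolynomial P y z))


coloured : ∀ {q} → Fin (suc q) → Bool
coloured zero    = false
coloured (suc _) = true

coloured-inject₁ : ∀ {q} (c : Fin (suc q)) → coloured (inject₁ c) ≡ coloured c
coloured-inject₁ zero    = refl
coloured-inject₁ (suc c) = refl

allColoured : ∀ {q k} → Vec (Fin (suc q)) k → Bool
allColoured []      = true
allColoured (c ∷ f) = coloured c ∧ allColoured f

allColoured⁺ : ∀ {q k} (f : Vec (Fin (suc q)) k) → (∀ v → coloured (lookup f v) ≡ true) → allColoured f ≡ true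
allColoured⁺ []          _      = refl
allColoured⁺ (zero ∷ f)  all-c  = all-c zero
allColoured⁺ (suc c ∷ f) all-c  = allColoured⁺ f (all-c ∘ suc)

sumℚ-allColoured : ∀ q k (h : Vec (Fin (suc q)) k → ℚ) →
  sumℚ (allVecs (suc q) k) (λ f → if allColoured f then h f else 0ℚ) ≡ sumℚ (allVecs q k) (h ∘ Vec.map suc)
sumℚ-allColoured q zero    h = refl
sumℚ-allColoured q (suc k) h =
  trans (sumℚ-allVecs-suc (suc q) k (λ f → if allColoured f then h f else 0ℚ))
    (trans (sumℚ-allFin-suc q (λ c → sumℚ (allVecs (suc q) k) (λ f → if allColoured (c ∷ f) then h (c ∷ f) else 0ℚ)))
      (trans (trans (cong (_+ rest) (sumℚ-zero (allVecs (suc q) k))) (ℚ.+-identityˡ rest))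
        (trans (sumℚ-cong (allFin q) (λ c → sumℚ-allColoured q k (λ f → h (suc c ∷ f))))
               (sym (sumℚ-allVecs-suc q k (h ∘ Vec.map suc))))))
  where
  rest : ℚ
  rest = sumℚ (allFin q) (λ c → sumℚ (allVecs (suc q) k) (λ f → if allColoured f then h (suc c ∷ f) else 0ℚ))

top : ∀ q → Fin (suc (suc q))
top q = fromℕ (suc q)

top-maximal : ∀ q (c : Fin (suc (suc q))) → ¬ (toℕ (top q) ℕ.< toℕ c)
top-maximal q c top<c = ℕ.<⇒≱ top<c (subst (toℕ c ℕ.≤_) (sym (Fin.toℕ-fromℕ (suc q))) (Fin.toℕ≤pred[n] c))

inject₁<top : ∀ q (c : Fin (suc q)) → toℕ (inject₁ c) ℕ.< toℕ (top q)
inject₁<top q c = subst₂ ℕ._<_ (sym (Fin.toℕ-inject₁ c)) (sym (Fin.toℕ-fromℕ (suc q))) (Fin.toℕ<n c)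

paintTop : ∀ {q k} → Subset k → Vec (Fin (suc q)) k → Vec (Fin (suc (suc q))) k
paintTop {q} = Vec.zipWith (λ b c → if b then top q else inject₁ c)

lookup-paintTop : ∀ {q k} (U : Subset k) (g : Vec (Fin (suc q)) k) v →
  lookup (paintTop U g) v ≡ (if lookup U v then top q else inject₁ (lookup g v))
lookup-paintTop U g v = Vec.lookup-zipWith _ v U g

paintTop-inside : ∀ {q k} (U : Subset k) (g : Vec (Fin (suc q)) k) {v} → lookup U v ≡ true →
  lookup (paintTop U g) v ≡ top q
paintTop-inside U g {v} Uv = trans (lookup-paintTop U g v) (cong (if_then _ else inject₁ (lookup g v)) Uv)

paintTop-outside : ∀ {q k} (U : Subset k) (g : Vec (Fin (suc q)) k) {v} → lookup U v ≡ false →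
  lookup (paintTop U g) v ≡ inject₁ (lookup g v)
paintTop-outside {q} U g {v} Uv = trans (lookup-paintTop U g v) (cong (if_then top q else _) Uv)

vanishesOn : ∀ {q k} → Subset k → Vec (Fin (suc q)) k → Bool
vanishesOn []      []      = true
vanishesOn (b ∷ U) (c ∷ g) = (not b ∨ not (coloured c)) ∧ vanishesOn U g

vanishesOn⁻ : ∀ {q k} (U : Subset k) (g : Vec (Fin (suc q)) k) →
  T (vanishesOn U g) → ∀ v → lookup U v ≡ true → coloured (lookup g v) ≡ false
vanishesOn⁻ (true ∷ U) (zero ∷ g) _   zero    _  = refl
vanishesOn⁻ (b ∷ U)    (c ∷ g)    van (suc v) Uv =
  vanishesOn⁻ U g (proj₂ (Equivalence.to (T-∧ {not b ∨ not (coloured c)}) van)) v Uv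

vanishesOn⁺ : ∀ {q k} (U : Subset k) (g : Vec (Fin (suc q)) k) →
  (∀ v → lookup U v ≡ true → coloured (lookup g v) ≡ false) → T (vanishesOn U g)
vanishesOn⁺ []          []         _   = tt
vanishesOn⁺ (false ∷ U) (c ∷ g)    van = vanishesOn⁺ U g (van ∘ suc)
vanishesOn⁺ (true ∷ U)  (zero ∷ g) van = vanishesOn⁺ U g (van ∘ suc)
vanishesOn⁺ (true ∷ U)  (suc c ∷ g) van with van zero refl
... | ()

-- A colouring with colours 0, …, q + 1 is recorded by its top colour class U and by the
-- colouring with colours 0, …, q that agrees with it off U and vanishes on U.
sumℚ-by-topClass : ∀ q k (h : Vec (Fin (suc (suc q))) k → ℚ) →
  sumℚ (allVecs (suc (suc q)) k) h ≡
  sumℚ (allSubsets k) (λ U → sumℚ (allVecs (suc q) k) (λ g → if vanishesOn U g then h (paintTop U g) else 0ℚ))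
sumℚ-by-topClass q zero    h = sym (ℚ.+-identityʳ _)
sumℚ-by-topClass q (suc k) h = begin
  sumℚ (allVecs (suc (suc q)) (suc k)) h
    ≡⟨ sumℚ-allVecs-suc (suc (suc q)) k h ⟩
  sumℚ (allFin (suc (suc q))) (λ c → sumℚ (allVecs (suc (suc q)) k) (λ f → h (c ∷ f)))
    ≡⟨ sumℚ-allFin-last (suc q) (λ c → sumℚ (allVecs (suc (suc q)) k) (λ f → h (c ∷ f))) ⟩
  sumℚ (allFin (suc q)) (λ d → sumℚ (allVecs (suc (suc q)) k) (λ f → h (inject₁ d ∷ f)))
    + sumℚ (allVecs (suc (suc q)) k) (λ f → h (top q ∷ f))
    ≡⟨ ℚ.+-comm (sumℚ (allFin (suc q)) (λ d → sumℚ (allVecs (suc (suc q)) k) (λ f → h (inject₁ d ∷ f))))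
                (sumℚ (allVecs (suc (suc q)) k) (λ f → h (top q ∷ f))) ⟩
  sumℚ (allVecs (suc (suc q)) k) (λ f → h (top q ∷ f))
    + sumℚ (allFin (suc q)) (λ d → sumℚ (allVecs (suc (suc q)) k) (λ f → h (inject₁ d ∷ f)))
    ≡⟨ cong₂ _+_ (sumℚ-by-topClass q k (λ f → h (top q ∷ f)))
                 (sumℚ-cong (allFin (suc q)) (λ d → sumℚ-by-topClass q k (λ f → h (inject₁ d ∷ f)))) ⟩
  sumℚ (allSubsets k) (λ U → lower U (λ g → h (top q ∷ paintTop U g)))
    + sumℚ (allFin (suc q)) (λ d → sumℚ (allSubsets k) (λ U → lower U (λ g → h (inject₁ d ∷ paintTop U g))))
    ≡⟨ cong₂ _+_ (sumℚ-cong (allSubsets k) (λ U → sym (onTop U)))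
                 (trans (sumℚ-comm (allFin (suc q)) (allSubsets k) _)
                        (sumℚ-cong (allSubsets k) (λ U → sym (sumℚ-allVecs-suc (suc q) k (term (outside ∷ U)))))) ⟩
  sumℚ (allSubsets k) (λ U → sumℚ (allVecs (suc q) (suc k)) (term (inside ∷ U)))
    + sumℚ (allSubsets k) (λ U → sumℚ (allVecs (suc q) (suc k)) (term (outside ∷ U)))
    ≡⟨ sumℚ-allSubsets-suc k (λ U → sumℚ (allVecs (suc q) (suc k)) (term U)) ⟨
  sumℚ (allSubsets (suc k)) (λ U → sumℚ (allVecs (suc q) (suc k)) (term U)) ∎
  where
  open ≡-Reasoning
  lower : Subset k → (Vec (Fin (suc q)) k → ℚ) → ℚ
  lower U φ = sumℚ (allVecs (suc q) k) (λ g → if vanishesOn U g then φ g else 0ℚ)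
  term : Subset (suc k) → Vec (Fin (suc q)) (suc k) → ℚ
  term U g = if vanishesOn U g then h (paintTop U g) else 0ℚ
  onTop : ∀ U → sumℚ (allVecs (suc q) (suc k)) (term (inside ∷ U)) ≡ lower U (λ g → h (top q ∷ paintTop U g))
  onTop U = trans (sumℚ-allVecs-suc (suc q) k (term (inside ∷ U)))
    (trans (sumℚ-allFin-suc q (λ c → sumℚ (allVecs (suc q) k) (λ g → term (inside ∷ U) (c ∷ g))))
      (trans (cong (lower U (λ g → h (top q ∷ paintTop U g)) +_)
                   (trans (sumℚ-cong (allFin q) (λ _ → sumℚ-zero (allVecs (suc q) k))) (sumℚ-zero (allFin q))))
             (ℚ.+-identityʳ _)))


module StrictColourings (D : MixedGraph) (S : Subset (m D)) where

  -- Colour zero marks the vertices outside the support; colours 1, …, q are the genuine colours.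
  Colouring : ℕ → Set
  Colouring q = Vec (Fin (suc q)) (n D)

  HasSupport : ∀ {q} → Subset (n D) → Colouring q → Set
  HasSupport W f = ∀ v → lookup W v ≡ coloured (lookup f v)

  Increasing : ∀ {q} → Colouring q → Set
  Increasing f = ∀ a → a ∉ S → T (coloured (lookup f (tail D a))) → T (coloured (lookup f (head D a))) →
    toℕ (lookup f (tail D a)) ℕ.< toℕ (lookup f (head D a))

  Good : ∀ {q} → Subset (n D) → Colouring q → Set
  Good W f = HasSupport W f × Increasing f

  good? : ∀ {q} W (f : Colouring q) → Dec (Good W f)
  good? W f =
    Fin.all? (λ v → lookup W v Bool.≟ coloured (lookup f v)) ×-dec
    Fin.all? (λ a → ¬? (a ∈? S) →-dec T? _ →-dec T? _ →-dec toℕ (lookup f (tail D a)) ℕ.<? toℕ (lookup f (head D a)))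

  -- The strict order polynomial, at k, of the subgraph of D ∖ S induced on W.
  strictCount : Subset (n D) → ℕ → ℚ
  strictCount W k = sumℚ (allVecs (suc k) (n D)) (λ f → if does (good? W f) then 1ℚ else 0ℚ)

  Good-uncoloured⇔ : ∀ W → Good W (Vec.replicate (n D) zero) ⇔ (¬ Nonempty W)
  Good-uncoloured⇔ W = mk⇔
    (λ (supp , _) (v , v∈W) → contradiction (trans (sym (∈⇒lookup v∈W)) (trans (supp v) (uncoloured v))) λ ())
    (λ W≡∅ → (λ v → trans (∉⇒lookup (λ v∈W → W≡∅ (v , v∈W))) (sym (uncoloured v))) ,
             (λ a _ c → ⊥-elim (subst T (uncoloured (tail D a)) c)))
    where
    uncoloured : ∀ v → coloured (lookup (Vec.replicate (n D) (zero {0})) v) ≡ false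
    uncoloured v = cong coloured (Vec.lookup-replicate v zero)

  strictCount-zero : ∀ W → strictCount W 0 ≡ (if does (nonempty? W) then 0ℚ else 1ℚ)
  strictCount-zero W =
    trans (sumℚ-allVecs-1 (n D) _)
      (trans (cong (if_then 1ℚ else 0ℚ) (does-⇔ (Good-uncoloured⇔ W) (good? W (Vec.replicate (n D) zero)) (¬? (nonempty? W))))
             (if-not (does (nonempty? W))))
    where
    if-not : ∀ b → (if not b then 1ℚ else 0ℚ) ≡ (if b then 0ℚ else 1ℚ)
    if-not true  = refl
    if-not false = refl

  ExitsInto : Subset (n D) → Fin (n D) → Fin (m D) → Set
  ExitsInto W v a = a ∉ S × tail D a ≡ v × lookup W (head D a) ≡ true

  IsSink : Subset (n D) → Fin (n D) → Set
  IsSink W v = lookup W v ≡ true × (∀ a → ¬ ExitsInto W v a)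

  exitsInto? : ∀ W v a → Dec (ExitsInto W v a)
  exitsInto? W v a = ¬? (a ∈? S) ×-dec tail D a Fin.≟ v ×-dec lookup W (head D a) Bool.≟ true

  isSink? : ∀ W v → Dec (IsSink W v)
  isSink? W v = lookup W v Bool.≟ true ×-dec Fin.all? (λ a → ¬? (exitsInto? W v a))

  sinks : Subset (n D) → Subset (n D)
  sinks W = Vec.tabulate (λ v → does (isSink? W v))

  ∈sinks⁻ : ∀ W {v} → v ∈ sinks W → IsSink W v
  ∈sinks⁻ W {v} v∈ = dec-true⁻ (isSink? W v) (trans (sym (Vec.lookup∘tabulate _ v)) (∈⇒lookup v∈))

  ∈sinks⁺ : ∀ W {v} → IsSink W v → v ∈ sinks W
  ∈sinks⁺ W {v} sink =
    lookup⇒∈ (trans (Vec.lookup∘tabulate _ v) (dec-true (isSink? W v) sink))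

  sinks⊆ : ∀ W → sinks W ⊆ W
  sinks⊆ W v∈ = lookup⇒∈ (proj₁ (∈sinks⁻ W v∈))

  non-sink-exits : ∀ W v → lookup W v ≡ true → ¬ IsSink W v → ∃ (ExitsInto W v)
  non-sink-exits W v Wv ¬sink with Fin.¬∀⟶∃¬ (m D) _ (λ a → ¬? (exitsInto? W v a)) (λ no-exit → ¬sink (Wv , no-exit))
  ... | a , ¬¬exit = a , decidable-stable (exitsInto? W v a) ¬¬exit

  -- Following exits forever revisits a vertex, by the pigeonhole principle.
  exits-everywhere⇒cycle : ∀ W → Nonempty W → (∀ v → lookup W v ≡ true → ∃ (ExitsInto W v)) → ¬ Acyclic D S
  exits-everywhere⇒cycle W (v₀ , v₀∈W) exits = revisit (Fin.pigeonhole (ℕ.n<1+n (n D)) (vertex ∘ toℕ))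
    where
    chain : ℕ → Σ (Fin (n D)) (λ v → lookup W v ≡ true)
    exit : ∀ i → ∃ (ExitsInto W (proj₁ (chain i)))
    chain zero    = v₀ , ∈⇒lookup v₀∈W
    chain (suc i) = head D (proj₁ (exit i)) , proj₂ (proj₂ (proj₂ (exit i)))
    exit i = exits (proj₁ (chain i)) (proj₂ (chain i))
    vertex : ℕ → Fin (n D)
    vertex = proj₁ ∘ chain
    walk : ∀ i l → Walk⁺ D S (vertex i) (vertex (suc l ℕ.+ i))
    walk i l = subst (λ x → Walk⁺ D S x (vertex (suc l ℕ.+ i))) (proj₁ (proj₂ (proj₂ (exit i)))) (from-head l)
      where
      a : Fin (m D)
      a = proj₁ (exit i)
      from-head : ∀ l → Walk⁺ D S (tail D a) (vertex (suc l ℕ.+ i))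
      from-head zero     = step a (proj₁ (proj₂ (exit i)))
      from-head (suc l′) = cons a (proj₁ (proj₂ (exit i)))
        (subst (λ j → Walk⁺ D S (head D a) (vertex (suc j))) (ℕ.+-suc l′ i) (walk (suc i) l′))
    revisit : (∃₂ λ i j → i Fin.< j × vertex (toℕ i) ≡ vertex (toℕ j)) → ¬ Acyclic D S
    revisit (i , j , i<j , same) acyclic with ℕ.m≤n⇒∃[o]m+o≡n i<j
    ... | l , i+l<j = acyclic (vertex (toℕ i))
      (subst (λ x → Walk⁺ D S (vertex (toℕ i)) x) (trans (cong (vertex ∘ suc) (ℕ.+-comm l (toℕ i))) (trans (cong vertex i+l<j) (sym same)))
        (walk (toℕ i) l))

  sinks-nonempty : Acyclic D S → ∀ W → Nonempty W → Nonempty (sinks W)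
  sinks-nonempty acyclic W W≢∅ with nonempty? (sinks W)
  ... | yes sinks≢∅ = sinks≢∅
  ... | no  sinks≡∅ = ⊥-elim (exits-everywhere⇒cycle W W≢∅
          (λ v Wv → non-sink-exits W v Wv (λ sink → sinks≡∅ (v , ∈sinks⁺ W sink))) acyclic)

  Removable : Subset (n D) → Subset (n D) → Set
  Removable W U = Nonempty U × U ⊆ sinks W

  removable? : ∀ W U → Dec (Removable W U)
  removable? W U = nonempty? U ×-dec U ⊆? sinks W

  module _ {q} (W U : Subset (n D)) (g : Colouring q) where

    private
      M : Colouring (suc q)
      M = paintTop U g

    paintTop-coloured : ∀ {v} → lookup U v ≡ false → coloured (lookup M v) ≡ coloured (lookup g v)
    paintTop-coloured {v} Uv = trans (cong coloured (paintTop-outside U g Uv)) (coloured-inject₁ (lookup g v))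

    topClass⁻ : T (vanishesOn U g) → Good W M → U ⊆ sinks W × Good (W ─ U) g
    topClass⁻ van (supp , inc) = (λ v∈U → ∈sinks⁺ W (sink (∈⇒lookup v∈U))) , supp′ , inc′
      where
      U-uncoloured : ∀ {v} → T (coloured (lookup g v)) → lookup U v ≡ false
      U-uncoloured {v} c with lookup U v in Uv
      ... | false = refl
      ... | true  = ⊥-elim (subst T (vanishesOn⁻ U g van v Uv) c)
      sink : ∀ {v} → lookup U v ≡ true → IsSink W v
      sink {v} Uv = trans (supp v) (cong coloured (paintTop-inside U g Uv)) , no-exit
        where
        no-exit : ∀ a → ¬ ExitsInto W v a
        no-exit a (a∉S , refl , Whd) =
          top-maximal q (lookup M (head D a))
            (subst (λ c → toℕ c ℕ.< toℕ (lookup M (head D a))) (paintTop-inside U g Uv)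
              (inc a a∉S (subst (T ∘ coloured) (sym (paintTop-inside U g Uv)) tt)
                         (Equivalence.from T-≡ (trans (sym (supp (head D a))) Whd))))
      supp′ : HasSupport (W ─ U) g
      supp′ v with lookup U v in Uv | lookup-─ W U v
      ... | true  | W─Uv = trans W─Uv (sym (vanishesOn⁻ U g van v Uv))
      ... | false | W─Uv = trans W─Uv (trans (supp v) (paintTop-coloured Uv))
      inc′ : Increasing g
      inc′ a a∉S ct ch =
        subst₂ ℕ._<_ (lift (tail D a) ct) (lift (head D a) ch)
          (inc a a∉S (subst T (sym (paintTop-coloured (U-uncoloured ct))) ct)
                     (subst T (sym (paintTop-coloured (U-uncoloured ch))) ch))
        where
        lift : ∀ v → T (coloured (lookup g v)) → toℕ (lookup M v) ≡ toℕ (lookup g v)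
        lift v c = trans (cong toℕ (paintTop-outside U g (U-uncoloured c))) (Fin.toℕ-inject₁ (lookup g v))

    topClass⁺ : U ⊆ sinks W → Good (W ─ U) g → T (vanishesOn U g) × Good W M
    topClass⁺ U⊆sinks (supp′ , inc′) = van , supp , inc
      where
      W─U-outside : ∀ {v} → lookup U v ≡ false → lookup (W ─ U) v ≡ lookup W v
      W─U-outside {v} Uv = trans (lookup-─ W U v) (cong (if_then false else lookup W v) Uv)
      van : T (vanishesOn U g)
      van = vanishesOn⁺ U g (λ v Uv → trans (sym (supp′ v)) (trans (lookup-─ W U v) (cong (if_then false else lookup W v) Uv)))
      sink : ∀ {v} → lookup U v ≡ true → IsSink W v
      sink Uv = ∈sinks⁻ W (U⊆sinks (lookup⇒∈ Uv))
      supp : HasSupport W M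
      supp v with lookup U v in Uv
      ... | true  = trans (proj₁ (sink Uv)) (sym (cong coloured (paintTop-inside U g Uv)))
      ... | false = trans (sym (W─U-outside Uv)) (trans (supp′ v) (sym (paintTop-coloured Uv)))
      inc : Increasing M
      inc a a∉S ct ch with lookup U (tail D a) in Ut | lookup U (head D a) in Uh
      ... | true  | _     = ⊥-elim (proj₂ (sink Ut) a (a∉S , refl , trans (supp (head D a)) (Equivalence.to T-≡ ch)))
      ... | false | true  = subst₂ (λ x y → toℕ x ℕ.< toℕ y) (sym (paintTop-outside U g Ut)) (sym (paintTop-inside U g Uh))
                              (inject₁<top q (lookup g (tail D a)))
      ... | false | false =
        subst₂ (λ x y → toℕ x ℕ.< toℕ y) (sym (paintTop-outside U g Ut)) (sym (paintTop-outside U g Uh))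
          (subst₂ ℕ._<_ (sym (Fin.toℕ-inject₁ (lookup g (tail D a)))) (sym (Fin.toℕ-inject₁ (lookup g (head D a))))
            (inc′ a a∉S (subst T (paintTop-coloured Ut) ct) (subst T (paintTop-coloured Uh) ch)))

    topClass⇔ : (T (vanishesOn U g) × Good W M) ⇔ (U ⊆ sinks W × Good (W ─ U) g)
    topClass⇔ = mk⇔ (λ (van , good) → topClass⁻ van good) (λ (U⊆ , good) → topClass⁺ U⊆ good)

  strictCount-suc : ∀ W k →
    strictCount W (suc k) ≡ sumℚ (allSubsets (n D)) (λ U → if does (U ⊆? sinks W) then strictCount (W ─ U) k else 0ℚ)
  strictCount-suc W k =
    trans (sumℚ-by-topClass k (n D) (λ f → if does (good? W f) then 1ℚ else 0ℚ))
      (sumℚ-cong (allSubsets (n D)) (λ U →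
        trans (sumℚ-cong (allVecs (suc k) (n D)) (λ g → by-topClass U g))
              (sumℚ-if (allVecs (suc k) (n D)) (does (U ⊆? sinks W)) _)))
    where
    by-topClass : ∀ U g →
      (if vanishesOn U g then (if does (good? W (paintTop U g)) then 1ℚ else 0ℚ) else 0ℚ) ≡
      (if does (U ⊆? sinks W) then (if does (good? (W ─ U) g) then 1ℚ else 0ℚ) else 0ℚ)
    by-topClass U g = begin
      _ ≡⟨ if-∧ (vanishesOn U g) (does (good? W (paintTop U g))) 1ℚ ⟩
      _ ≡⟨ cong (if_then 1ℚ else 0ℚ) (does-⇔ (topClass⇔ W U g) (T? (vanishesOn U g) ×-dec good? W (paintTop U g)) (U ⊆? sinks W ×-dec good? (W ─ U) g)) ⟩
      _ ≡⟨ if-∧ (does (U ⊆? sinks W)) (does (good? (W ─ U) g)) 1ℚ ⟨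
      _ ∎
      where open ≡-Reasoning

  Δ-strictCount : ∀ W k →
    Δ (strictCount W) k ≡
    sumℚ (allSubsets (n D)) (λ U → if does (removable? W U) then strictCount (W ─ U) k else 0ℚ)
  Δ-strictCount W k = begin
    strictCount W (suc k) - strictCount W k
      ≡⟨ cong (_- strictCount W k) (trans (strictCount-suc W k) (sumℚ-allSubsets-∅ (n D) φ)) ⟩
    φ ∅ + sumℚ (allSubsets (n D)) (λ U → if does (nonempty? U) then φ U else 0ℚ) - strictCount W k
      ≡⟨ cong (λ x → x + sumℚ (allSubsets (n D)) (λ U → if does (nonempty? U) then φ U else 0ℚ) - strictCount W k) φ∅ ⟩
    strictCount W k + sumℚ (allSubsets (n D)) (λ U → if does (nonempty? U) then φ U else 0ℚ) - strictCount W k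
      ≡⟨ a+b-a≡b (strictCount W k) _ ⟩
    sumℚ (allSubsets (n D)) (λ U → if does (nonempty? U) then φ U else 0ℚ)
      ≡⟨ sumℚ-cong (allSubsets (n D)) (λ U → if-∧ (does (nonempty? U)) (does (U ⊆? sinks W)) _) ⟩
    sumℚ (allSubsets (n D)) (λ U → if does (removable? W U) then strictCount (W ─ U) k else 0ℚ) ∎
    where
    open ≡-Reasoning
    φ : Subset (n D) → ℚ
    φ U = if does (U ⊆? sinks W) then strictCount (W ─ U) k else 0ℚ
    φ∅ : φ ∅ ≡ strictCount W k
    φ∅ = trans (cong (if_then strictCount (W ─ ∅) k else 0ℚ) (dec-true (∅ ⊆? sinks W) ⊥⊆))
               (cong (λ X → strictCount X k) (p─⊥≡p W))

  strictCount-empty : ∀ W → ¬ Nonempty W → ∀ k → strictCount W k ≡ 1ℚ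
  strictCount-empty W W≡∅ zero    = trans (strictCount-zero W) (cong (if_then 0ℚ else 1ℚ) (dec-false (nonempty? W) W≡∅))
  strictCount-empty W W≡∅ (suc k) = begin
    strictCount W (suc k)                   ≡⟨ Δ-suc (strictCount W) k ⟩
    strictCount W k + Δ (strictCount W) k   ≡⟨ cong₂ _+_ (strictCount-empty W W≡∅ k) (trans (Δ-strictCount W k) no-removable) ⟩
    1ℚ + 0ℚ                                 ≡⟨ ℚ.+-identityʳ 1ℚ ⟩
    1ℚ                                      ∎
    where
    open ≡-Reasoning
    no-removable : sumℚ (allSubsets (n D)) (λ U → if does (removable? W U) then strictCount (W ─ U) k else 0ℚ) ≡ 0ℚ
    no-removable = trans (sumℚ-cong (allSubsets (n D)) (λ U → cong (if_then strictCount (W ─ U) k else 0ℚ)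
                     (dec-false (removable? W U) (λ ((v , v∈U) , U⊆) → W≡∅ (v , sinks⊆ W (U⊆ v∈U))))))
                     (sumℚ-zero (allSubsets (n D)))

  -- Over the nonempty sets U of sinks, ∑ (−1)^|U| = −1.
  removal-signs : Acyclic D S → ∀ W {d} → ∣ W ∣ ≡ suc d →
    sumℚ (allSubsets (n D)) (λ U → if does (removable? W U) then (- 1ℚ) ^ ∣ W ─ U ∣ else 0ℚ) ≡ (- 1ℚ) ^ suc d * - 1ℚ
  removal-signs acyclic W {d} ∣W∣≡1+d = begin
    sumℚ (allSubsets (n D)) (λ U → if does (removable? W U) then (- 1ℚ) ^ ∣ W ─ U ∣ else 0ℚ)
      ≡⟨ sumℚ-cong (allSubsets (n D)) (λ U → sign U (removable? W U)) ⟩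
    sumℚ (allSubsets (n D)) (λ U → (- 1ℚ) ^ suc d * (if does (removable? W U) then (- 1ℚ) ^ ∣ U ∣ else 0ℚ))
      ≡⟨ *-distribˡ-sumℚ ((- 1ℚ) ^ suc d) (allSubsets (n D)) _ ⟨
    (- 1ℚ) ^ suc d * sumℚ (allSubsets (n D)) (λ U → if does (removable? W U) then (- 1ℚ) ^ ∣ U ∣ else 0ℚ)
      ≡⟨ cong ((- 1ℚ) ^ suc d *_) (alternating-sum-nonempty-⊆ (sinks W) (sinks-nonempty acyclic W (∣p∣≡1+d⇒Nonempty W ∣W∣≡1+d))) ⟩
    (- 1ℚ) ^ suc d * - 1ℚ ∎
    where
    open ≡-Reasoning
    sign : ∀ U (r : Dec (Removable W U)) →
      (if does r then (- 1ℚ) ^ ∣ W ─ U ∣ else 0ℚ) ≡ (- 1ℚ) ^ suc d * (if does r then (- 1ℚ) ^ ∣ U ∣ else 0ℚ)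
    sign U (no _)         = sym (ℚ.*-zeroʳ ((- 1ℚ) ^ suc d))
    sign U (yes (_ , U⊆)) = -1^-split {∣ W ─ U ∣} {∣ U ∣} (trans (∣p─q∣+∣q∣≡∣p∣ W U (λ v∈U → sinks⊆ W (U⊆ v∈U))) ∣W∣≡1+d)

  -- Reciprocity at −1: Ω°(−1) = (−1)^|W|, by strong induction on |W|, since removing a nonempty
  -- set of sinks lowers the degree.
  strictCount-extrapolates : Acyclic D S → ∀ W → ExtrapolatesTo ∣ W ∣ (strictCount W) ((- 1ℚ) ^ ∣ W ∣)
  strictCount-extrapolates acyclic W = <-rec P extrapolate ∣ W ∣ W refl
    where
    P : ℕ → Set
    P d = ∀ W → ∣ W ∣ ≡ d → ExtrapolatesTo d (strictCount W) ((- 1ℚ) ^ d)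
    extrapolate : ∀ d → (∀ {d′} → d′ ℕ.< d → P d′) → P d
    extrapolate zero    _  W ∣W∣≡0 =
      strictCount-empty W (λ (v , v∈W) → ℕ.n≮0 (subst (ℕ._<_ _) ∣W∣≡0 (x∈p⇒∣p-x∣<∣p∣ v∈W)))
    extrapolate (suc d) IH W ∣W∣≡1+d =
      _ , ExtrapolatesTo-resp d (λ k → sym (Δ-strictCount W k)) (ExtrapolatesTo-sumℚ d (allSubsets (n D)) (λ U → per U (removable? W U))) ,
      (begin
        strictCount W 0 - _                 ≡⟨ cong₂ _-_ (trans (strictCount-zero W) (cong (if_then 0ℚ else 1ℚ) (dec-true (nonempty? W) (∣p∣≡1+d⇒Nonempty W ∣W∣≡1+d))))
                                                           (removal-signs acyclic W ∣W∣≡1+d) ⟩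
        0ℚ - (- 1ℚ) ^ suc d * - 1ℚ          ≡⟨ solve 1 (λ x → con 0ℚ :- x :* con (- 1ℚ) := x) refl ((- 1ℚ) ^ suc d) ⟩
        (- 1ℚ) ^ suc d                      ∎)
      where
      open ≡-Reasoning
      per : ∀ U (r : Dec (Removable W U)) →
        ExtrapolatesTo d (λ k → if does r then strictCount (W ─ U) k else 0ℚ) (if does r then (- 1ℚ) ^ ∣ W ─ U ∣ else 0ℚ)
      per U (no _) = ExtrapolatesTo-0 d
      per U (yes ((v , v∈U) , U⊆)) = ExtrapolatesTo-mono (ℕ.s≤s⁻¹ smaller) (IH smaller (W ─ U) refl)
        where
        smaller : ∣ W ─ U ∣ ℕ.< suc d
        smaller = subst (ℕ._<_ _) ∣W∣≡1+d (p∩q≢∅⇒∣p─q∣<∣p∣ W U (v , x∈p∩q⁺ (sinks⊆ W (U⊆ v∈U) , v∈U)))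

  ascends : ∀ {k} → Vec (Fin k) (n D) → Fin (m D) → Bool
  ascends f a = does (toℕ (lookup f (tail D a)) ℕ.<? toℕ (lookup f (head D a)))

  allAscend : ∀ {k} → Vec (Fin k) (n D) → Bool
  allAscend f = allB (λ a → lookup S a ∨ ascends f a) (allFin (m D))

  ascendingCount : ℕ → ℚ
  ascendingCount k = sumℚ (allVecs k (n D)) (λ f → if allAscend f then 1ℚ else 0ℚ)

  allAscend⁻ : ∀ {k} (f : Vec (Fin k) (n D)) → T (allAscend f) →
    ∀ a → a ∉ S → toℕ (lookup f (tail D a)) ℕ.< toℕ (lookup f (head D a))
  allAscend⁻ f asc a a∉S with lookup S a in Sa | allB-allFin⁻ (m D) _ asc a
  ... | true  | _  = contradiction (lookup⇒∈ Sa) a∉S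
  ... | false | up = dec-true⁻ (_ ℕ.<? _) (Equivalence.to T-≡ up)

  allAscend⁺ : ∀ {k} (f : Vec (Fin k) (n D)) →
    (∀ a → a ∉ S → toℕ (lookup f (tail D a)) ℕ.< toℕ (lookup f (head D a))) → T (allAscend f)
  allAscend⁺ f up = allB-allFin⁺ (m D) _ ascends-off-S
    where
    ascends-off-S : ∀ a → T (lookup S a ∨ ascends f a)
    ascends-off-S a with lookup S a in Sa
    ... | true  = tt
    ... | false = Equivalence.from T-≡ (dec-true (_ ℕ.<? _) (up a (λ a∈S → contradiction (trans (sym (∈⇒lookup a∈S)) Sa) λ ())))

  ascending-walk : ∀ {k} (f : Vec (Fin k) (n D)) → T (allAscend f) →
    ∀ {u v} → Walk⁺ D S u v → toℕ (lookup f u) ℕ.< toℕ (lookup f v)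
  ascending-walk f asc (step a a∉S)   = allAscend⁻ f asc a a∉S
  ascending-walk f asc (cons a a∉S w) = ℕ.<-trans (allAscend⁻ f asc a a∉S) (ascending-walk f asc w)

  ascendingCount-cyclic : ¬ Acyclic D S → ∀ k → ascendingCount k ≡ 0ℚ
  ascendingCount-cyclic cyclic k =
    trans (sumℚ-cong (allVecs k (n D)) (λ f → cong (if_then 1ℚ else 0ℚ) (never f))) (sumℚ-zero (allVecs k (n D)))
    where
    never : ∀ f → allAscend f ≡ false
    never f with allAscend f in asc
    ... | false = refl
    ... | true  = ⊥-elim (cyclic (λ v w → ℕ.<-irrefl refl (ascending-walk f (Equivalence.from T-≡ asc) w)))

  Good-⊤-map-suc⇔ : ∀ {k} (f : Vec (Fin k) (n D)) → Good ⊤ (Vec.map suc f) ⇔ T (allAscend f)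
  Good-⊤-map-suc⇔ f = mk⇔
    (λ (_ , inc) → allAscend⁺ f (λ a a∉S →
      ℕ.s<s⁻¹ (subst₂ (λ x y → toℕ x ℕ.< toℕ y) (lookup-suc (tail D a)) (lookup-suc (head D a))
        (inc a a∉S (coloured-suc (tail D a)) (coloured-suc (head D a))))))
    (λ asc → (λ v → trans (Vec.lookup-replicate v true) (sym (cong coloured (lookup-suc v)))) ,
             (λ a a∉S _ _ → subst₂ (λ x y → toℕ x ℕ.< toℕ y) (sym (lookup-suc (tail D a))) (sym (lookup-suc (head D a)))
                              (ℕ.s<s (allAscend⁻ f asc a a∉S))))
    where
    lookup-suc : ∀ v → lookup (Vec.map suc f) v ≡ suc (lookup f v)
    lookup-suc v = Vec.lookup-map v suc f
    coloured-suc : ∀ v → T (coloured (lookup (Vec.map suc f) v))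
    coloured-suc v = subst (T ∘ coloured) (sym (lookup-suc v)) tt

  strictCount⊤≡ascendingCount : ∀ k → strictCount ⊤ k ≡ ascendingCount k
  strictCount⊤≡ascendingCount k = begin
    strictCount ⊤ k
      ≡⟨ sumℚ-cong (allVecs (suc k) (n D)) (λ f → only-coloured f (good? ⊤ f)) ⟩
    sumℚ (allVecs (suc k) (n D)) (λ f → if allColoured f then (if does (good? ⊤ f) then 1ℚ else 0ℚ) else 0ℚ)
      ≡⟨ sumℚ-allColoured k (n D) (λ f → if does (good? ⊤ f) then 1ℚ else 0ℚ) ⟩
    sumℚ (allVecs k (n D)) (λ f → if does (good? ⊤ (Vec.map suc f)) then 1ℚ else 0ℚ)
      ≡⟨ sumℚ-cong (allVecs k (n D)) (λ f →
           cong (if_then 1ℚ else 0ℚ) (does-⇔ (Good-⊤-map-suc⇔ f) (good? ⊤ (Vec.map suc f)) (T? (allAscend f)))) ⟩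
    ascendingCount k ∎
    where
    open ≡-Reasoning
    only-coloured : ∀ f (r : Dec (Good ⊤ f)) →
      (if does r then 1ℚ else 0ℚ) ≡ (if allColoured f then (if does r then 1ℚ else 0ℚ) else 0ℚ)
    only-coloured f (yes (supp , _)) =
      sym (cong (if_then 1ℚ else 0ℚ) (allColoured⁺ f (λ v → trans (sym (supp v)) (Vec.lookup-replicate v true))))
    only-coloured f (no _) with allColoured f
    ... | true  = refl
    ... | false = refl

  ascendingCount-extrapolates : (acyclic? : Dec (Acyclic D S)) →
    ExtrapolatesTo (n D) ascendingCount (if does acyclic? then (- 1ℚ) ^ n D else 0ℚ)
  ascendingCount-extrapolates (yes acyclic) =
    ExtrapolatesTo-resp (n D) strictCount⊤≡ascendingCount
      (subst (λ d → ExtrapolatesTo d (strictCount ⊤) ((- 1ℚ) ^ d)) (∣⊤∣≡n (n D)) (strictCount-extrapolates acyclic ⊤))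
  ascendingCount-extrapolates (no cyclic) =
    ExtrapolatesTo-resp (n D) (λ k → sym (ascendingCount-cyclic cyclic k)) (ExtrapolatesTo-0 (n D))

Bsum-expand : ∀ D k t →
  Bsum D k (1ℚ + t) 1ℚ ≡ sumℚ (allSubsets (m D)) (λ S → t ^ ∣ ∁ S ∣ * StrictColourings.ascendingCount D S k)
Bsum-expand D k t = begin
  sumℚ (allVecs k (n D)) (λ f → (1ℚ + t) ^ ascents D f * 1ℚ ^ descents D f)
    ≡⟨ sumℚ-cong (allVecs k (n D)) (λ f → trans (cong ((1ℚ + t) ^ ascents D f *_) (1^k≡1 (descents D f)))
                                         (trans (ℚ.*-identityʳ _) (binomial-subsets t (m D) _))) ⟩
  sumℚ (allVecs k (n D)) (λ f → sumℚ (allSubsets (m D)) (λ S → if allAscend S f then t ^ ∣ ∁ S ∣ else 0ℚ))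
    ≡⟨ sumℚ-comm (allVecs k (n D)) (allSubsets (m D)) _ ⟩
  sumℚ (allSubsets (m D)) (λ S → sumℚ (allVecs k (n D)) (λ f → if allAscend S f then t ^ ∣ ∁ S ∣ else 0ℚ))
    ≡⟨ sumℚ-cong (allSubsets (m D)) (λ S →
         trans (sumℚ-cong (allVecs k (n D)) (λ f → if-0ℚ-*-indicator (allAscend S f) (t ^ ∣ ∁ S ∣)))
               (sym (*-distribˡ-sumℚ (t ^ ∣ ∁ S ∣) (allVecs k (n D)) _))) ⟩
  sumℚ (allSubsets (m D)) (λ S → t ^ ∣ ∁ S ∣ * StrictColourings.ascendingCount D S k) ∎
  where
  open ≡-Reasoning
  allAscend : Subset (m D) → Vec (Fin k) (n D) → Bool
  allAscend S = StrictColourings.allAscend D S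

acyclicWeight : (D : MixedGraph) → (∀ S → Dec (Acyclic D S)) → ℚ → ℚ
acyclicWeight D acyclic? t = sumℚ (allSubsets (m D)) (λ S → if does (acyclic? S) then t ^ ∣ ∁ S ∣ else 0ℚ)

-- Stanley reciprocity for the strict order polynomials of all D ∖ S, weighted by t^|A ∖ S|.
B-at-minus-one : ∀ D (acyclic? : ∀ S → Dec (Acyclic D S)) P → IsBPoly D P → ∀ t →
  eval3 P (- 1ℚ) (1ℚ + t) 1ℚ ≡ (- 1ℚ) ^ n D * acyclicWeight D acyclic? t
B-at-minus-one D acyclic? P isB t =
  trans (ExtrapolatesTo-unique-suc (qDegree P ℕ.+ n D) P→ B→ (λ k → isB (suc k) (s≤s z≤n) (1ℚ + t) 1ℚ))
    (trans (sumℚ-cong (allSubsets (m D)) (λ S → swap (does (acyclic? S)) (t ^ ∣ ∁ S ∣)))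
           (sym (*-distribˡ-sumℚ ((- 1ℚ) ^ n D) (allSubsets (m D)) _)))
  where
  P→ : ExtrapolatesTo (qDegree P ℕ.+ n D) (λ k → eval3 P (ℕ→ℚ k) (1ℚ + t) 1ℚ) (eval3 P (- 1ℚ) (1ℚ + t) 1ℚ)
  P→ = ExtrapolatesTo-mono (ℕ.m≤m+n (qDegree P) (n D))
         (IsPolynomial⇒ExtrapolatesTo (qDegree P) (eval3-isPolynomial P (1ℚ + t) 1ℚ))
  B→ : ExtrapolatesTo (qDegree P ℕ.+ n D) (λ k → Bsum D k (1ℚ + t) 1ℚ)
                      (sumℚ (allSubsets (m D)) (λ S → t ^ ∣ ∁ S ∣ * (if does (acyclic? S) then (- 1ℚ) ^ n D else 0ℚ)))
  B→ = ExtrapolatesTo-mono (ℕ.m≤n+m (n D) (qDegree P))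
         (ExtrapolatesTo-resp (n D) (λ k → sym (Bsum-expand D k t))
           (ExtrapolatesTo-sumℚ (n D) (allSubsets (m D))
             (λ S → ExtrapolatesTo-* (n D) (t ^ ∣ ∁ S ∣) (StrictColourings.ascendingCount-extrapolates D S (acyclic? S)))))
  swap : ∀ b x → x * (if b then (- 1ℚ) ^ n D else 0ℚ) ≡ (- 1ℚ) ^ n D * (if b then x else 0ℚ)
  swap true  x = ℚ.*-comm x _
  swap false x = trans (ℚ.*-zeroʳ x) (sym (ℚ.*-zeroʳ ((- 1ℚ) ^ n D)))


module _ (D : MixedGraph) where

  isRepresentative : Fin (m D) → Bool
  isRepresentative a = does (toℕ a ℕ.≤? toℕ (partner D a))

  non-representative : ∀ a → ¬ T (isRepresentative a) → toℕ (partner D a) < toℕ a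
  non-representative a ¬rep = ℕ.≰⇒> ¬rep≤
    where
    ¬rep≤ : ¬ toℕ a ≤ toℕ (partner D a)
    ¬rep≤ a≤πa = ¬rep (Equivalence.from T-≡ (dec-true (_ ℕ.≤? _) a≤πa))

  kept : Subset (m D) → Fin (m D) → Bool
  kept S a = not (lookup S a)

  kept⇒∉ : ∀ {S a} → T (kept S a) → a ∉ S
  kept⇒∉ k a∈S = subst (T ∘ not) (Vec.[]=⇒lookup a∈S) k

  -- Both arcs of an unoriented edge surviving in D ∖ S would form a directed 2-cycle.
  partner-kept⇒dropped : ∀ S → Acyclic D S → ∀ a →
    T (kept S (partner D a) ∧ not (isRepresentative (partner D a))) → T (isRepresentative a ∧ not (kept S a))
  partner-kept⇒dropped S acyclic a πa-kept∧¬rep = Equivalence.from T-∧ (rep-a , ¬¬kept-a)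
    where
    πa-kept : T (kept S (partner D a))
    πa-kept = proj₁ (Equivalence.to T-∧ πa-kept∧¬rep)
    a<πa : toℕ a < toℕ (partner D a)
    a<πa = subst (λ x → toℕ x < toℕ (partner D a)) (partner-invol D a)
             (non-representative (partner D a) (T-not⇒¬T (proj₂ (Equivalence.to T-∧ πa-kept∧¬rep))))
    πa≢a : partner D a ≢ a
    πa≢a πa≡a = ℕ.<-irrefl (cong toℕ (sym πa≡a)) a<πa
    rep-a : T (isRepresentative a)
    rep-a = Equivalence.from T-≡ (dec-true (_ ℕ.≤? _) (ℕ.<⇒≤ a<πa))
    ¬¬kept-a : T (not (kept S a))
    ¬¬kept-a = ¬T⇒T-not (λ kept-a → acyclic (tail D a) (cons a (kept⇒∉ kept-a)
      (subst₂ (Walk⁺ D S) (partner-opp-tail D a πa≢a) (partner-opp-head D a πa≢a) (step (partner D a) (kept⇒∉ πa-kept)))))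

  -- The partner involution trades the kept non-representatives for dropped representatives.
  kept-arcs≤numEdges : ∀ S → Acyclic D S → ∣ ∁ S ∣ ≤ numEdges D
  kept-arcs≤numEdges S acyclic = begin
    ∣ ∁ S ∣                                               ≡⟨ ∣∁p∣≡count (m D) S ⟩
    count (allFin (m D)) (kept S)                         ≡⟨ count-split (m D) (kept S) rep ⟩
    count (allFin (m D)) (λ a → kept S a ∧ rep a) ℕ.+ count (allFin (m D)) (λ a → kept S a ∧ not (rep a))
      ≡⟨ cong₂ ℕ._+_ (count-cong (m D) (λ a → ∧-comm (kept S a) (rep a)))
                     (sym (count-involution (m D) (partner D) (partner-invol D) (λ a → kept S a ∧ not (rep a)))) ⟩
    count (allFin (m D)) (λ a → rep a ∧ kept S a) ℕ.+ count (allFin (m D)) (λ a → kept S (partner D a) ∧ not (rep (partner D a)))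
      ≤⟨ ℕ.+-monoʳ-≤ (count (allFin (m D)) (λ a → rep a ∧ kept S a)) (count-mono (m D) (partner-kept⇒dropped S acyclic)) ⟩
    count (allFin (m D)) (λ a → rep a ∧ kept S a) ℕ.+ count (allFin (m D)) (λ a → rep a ∧ not (kept S a))
      ≡⟨ count-split (m D) rep (kept S) ⟨
    numEdges D                                            ∎
    where
    open ℕ.≤-Reasoning
    rep : Fin (m D) → Bool
    rep = isRepresentative

module Roots {n} {R : Fin n → Fin n → Set} (R? : ∀ u v → Dec (R u v)) where

  isRoot : Fin n → Bool
  isRoot v = allB (λ u → not (does (toℕ u ℕ.<? toℕ v)) ∨ not (does (R? u v))) (allFin n)

  roots : ℕ
  roots = count (allFin n) isRoot

  root⁻ : ∀ {v} → T (isRoot v) → ∀ u → toℕ u < toℕ v → ¬ R u v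
  root⁻ {v} root u u<v Ruv with allB-allFin⁻ n _ root u
  ... | t rewrite Equivalence.to T-≡ (ℕ.<⇒<ᵇ u<v) | dec-true (R? u v) Ruv = t

  root⁺ : ∀ {v} → (∀ u → toℕ u < toℕ v → ¬ R u v) → T (isRoot v)
  root⁺ {v} no-smaller = allB-allFin⁺ n _ checked
    where
    checked : ∀ u → T (not (does (toℕ u ℕ.<? toℕ v)) ∨ not (does (R? u v)))
    checked u with toℕ u ℕ.<ᵇ toℕ v in u<ᵇv | R? u v
    ... | true  | yes Ruv = no-smaller u (ℕ.<ᵇ⇒< _ _ (Equivalence.from T-≡ u<ᵇv)) Ruv
    ... | true  | no _    = tt
    ... | false | _       = tt

  non-root : ∀ {v} → ¬ T (isRoot v) → ∃ λ u → toℕ u < toℕ v × R u v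
  non-root {v} ¬root with Fin.any? (λ u → toℕ u ℕ.<? toℕ v ×-dec R? u v)
  ... | yes found = found
  ... | no none   = ⊥-elim (¬root (root⁺ (λ u u<v Ruv → none (u , u<v , Ruv))))

  roots-unique : (∀ {u v} → R u v → R v u) → ∀ {v v′} → T (isRoot v) → T (isRoot v′) → R v v′ → v ≡ v′
  roots-unique sym-R {v} {v′} root root′ Rvv′ with ℕ.<-cmp (toℕ v) (toℕ v′)
  ... | tri< v<v′ _ _ = ⊥-elim (root⁻ root′ v v<v′ Rvv′)
  ... | tri≈ _ v≡v′ _ = Fin.toℕ-injective v≡v′
  ... | tri> _ _ v′<v = ⊥-elim (root⁻ root v′ v′<v (sym-R Rvv′))

roots-cong : ∀ {n} {R R′ : Fin n → Fin n → Set} (R? : ∀ u v → Dec (R u v)) (R′? : ∀ u v → Dec (R′ u v)) →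
  (∀ u v → R u v ⇔ R′ u v) → Roots.roots R? ≡ Roots.roots R′?
roots-cong {n} R? R′? R⇔R′ =
  count-cong n (λ v → allB-cong (allFin n) (λ u →
    cong (λ b → not (does (toℕ u ℕ.<? toℕ v)) ∨ not b) (does-⇔ (R⇔R′ u v) (R? u v) (R′? u v))))

module Connectivity (D : MixedGraph) where

  data ConnectedBelow (k : ℕ) : Fin (n D) → Fin (n D) → Set where
    here : ∀ {u} → ConnectedBelow k u u
    fwd  : ∀ {u} a → toℕ a < k → ConnectedBelow k u (tail D a) → ConnectedBelow k u (head D a)
    bwd  : ∀ {u} a → toℕ a < k → ConnectedBelow k u (head D a) → ConnectedBelow k u (tail D a)

  module _ {k : ℕ} where

    connectedBelow-trans : ∀ {u v w} → ConnectedBelow k u v → ConnectedBelow k v w → ConnectedBelow k u w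
    connectedBelow-trans p here         = p
    connectedBelow-trans p (fwd a a<k q) = fwd a a<k (connectedBelow-trans p q)
    connectedBelow-trans p (bwd a a<k q) = bwd a a<k (connectedBelow-trans p q)

    connectedBelow-sym : ∀ {u v} → ConnectedBelow k u v → ConnectedBelow k v u
    connectedBelow-sym here          = here
    connectedBelow-sym (fwd a a<k p) = connectedBelow-trans (bwd a a<k here) (connectedBelow-sym p)
    connectedBelow-sym (bwd a a<k p) = connectedBelow-trans (fwd a a<k here) (connectedBelow-sym p)

  connectedBelow-mono : ∀ {k k′} → k ≤ k′ → ∀ {u v} → ConnectedBelow k u v → ConnectedBelow k′ u v
  connectedBelow-mono k≤k′ here          = here
  connectedBelow-mono k≤k′ (fwd a a<k p) = fwd a (ℕ.<-≤-trans a<k k≤k′) (connectedBelow-mono k≤k′ p)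
  connectedBelow-mono k≤k′ (bwd a a<k p) = bwd a (ℕ.<-≤-trans a<k k≤k′) (connectedBelow-mono k≤k′ p)

  connectedBelow-all⇔ : ∀ u v → ConnectedBelow (m D) u v ⇔ Connected D u v
  connectedBelow-all⇔ u v = mk⇔ to from
    where
    to : ∀ {u v} → ConnectedBelow (m D) u v → Connected D u v
    to here        = here
    to (fwd a _ p) = fwd a (to p)
    to (bwd a _ p) = bwd a (to p)
    from : ∀ {u v} → Connected D u v → ConnectedBelow (m D) u v
    from here      = here
    from (fwd a p) = fwd a (Fin.toℕ<n a) (from p)
    from (bwd a p) = bwd a (Fin.toℕ<n a) (from p)

  connectedBelow-zero⇒≡ : ∀ {u v} → ConnectedBelow 0 u v → u ≡ v
  connectedBelow-zero⇒≡ here = refl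

  connectedBelow-zero? : ∀ u v → Dec (ConnectedBelow 0 u v)
  connectedBelow-zero? u v = map′ (λ { refl → here }) connectedBelow-zero⇒≡ (u Fin.≟ v)

  edgesBelow : ℕ → ℕ
  edgesBelow k = count (allFin (m D)) (λ a → isRepresentative D a ∧ (toℕ a ℕ.<ᵇ k))

  module Step (k : ℕ) (a₀ : Fin (m D)) (a₀≡k : toℕ a₀ ≡ k) where

    private
      t₀ h₀ : Fin (n D)
      t₀ = tail D a₀
      h₀ = head D a₀
      a₀<1+k : toℕ a₀ < suc k
      a₀<1+k = subst (_< suc k) (sym a₀≡k) (ℕ.n<1+n k)
      k≤1+k : k ≤ suc k
      k≤1+k = ℕ.n≤1+n k
      lift : ∀ {u v} → ConnectedBelow k u v → ConnectedBelow (suc k) u v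
      lift = connectedBelow-mono k≤1+k

    Joined : Fin (n D) → Fin (n D) → Set
    Joined u v = ConnectedBelow k u v ⊎ (ConnectedBelow k u t₀ × ConnectedBelow k h₀ v)
                                     ⊎ (ConnectedBelow k u h₀ × ConnectedBelow k t₀ v)

    extend : ∀ {u v w} → Joined u v → ConnectedBelow k v w → Joined u w
    extend (inj₁ p)              q = inj₁ (connectedBelow-trans p q)
    extend (inj₂ (inj₁ (p , r))) q = inj₂ (inj₁ (p , connectedBelow-trans r q))
    extend (inj₂ (inj₂ (p , r))) q = inj₂ (inj₂ (p , connectedBelow-trans r q))

    joined⁺ : ∀ {u v} → ConnectedBelow (suc k) u v → Joined u v
    joined⁺ here = inj₁ here
    joined⁺ (fwd a a<1+k p) with ℕ.m<1+n⇒m<n∨m≡n a<1+k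
    ... | inj₁ a<k = extend (joined⁺ p) (fwd a a<k here)
    ... | inj₂ a≡k with Fin.toℕ-injective {i = a} {j = a₀} (trans a≡k (sym a₀≡k))
    ...   | refl with joined⁺ p
    ...     | inj₁ q              = inj₂ (inj₁ (q , here))
    ...     | inj₂ (inj₁ (q , _)) = inj₂ (inj₁ (q , here))
    ...     | inj₂ (inj₂ (q , _)) = inj₁ q
    joined⁺ (bwd a a<1+k p) with ℕ.m<1+n⇒m<n∨m≡n a<1+k
    ... | inj₁ a<k = extend (joined⁺ p) (bwd a a<k here)
    ... | inj₂ a≡k with Fin.toℕ-injective {i = a} {j = a₀} (trans a≡k (sym a₀≡k))
    ...   | refl with joined⁺ p
    ...     | inj₁ q              = inj₂ (inj₂ (q , here))
    ...     | inj₂ (inj₁ (q , _)) = inj₁ q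
    ...     | inj₂ (inj₂ (q , _)) = inj₂ (inj₂ (q , here))

    joined⁻ : ∀ {u v} → Joined u v → ConnectedBelow (suc k) u v
    joined⁻ (inj₁ p)              = lift p
    joined⁻ (inj₂ (inj₁ (p , q))) = connectedBelow-trans (fwd a₀ a₀<1+k (lift p)) (lift q)
    joined⁻ (inj₂ (inj₂ (p , q))) = connectedBelow-trans (bwd a₀ a₀<1+k (lift p)) (lift q)

    decide : (∀ u v → Dec (ConnectedBelow k u v)) → ∀ u v → Dec (ConnectedBelow (suc k) u v)
    decide conn? u v = map′ joined⁻ joined⁺
      (conn? u v ⊎-dec (conn? u t₀ ×-dec conn? h₀ v) ⊎-dec (conn? u h₀ ×-dec conn? t₀ v))

    -- The partner of a non-representative arc has a smaller index and joins the same vertices.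
    head-to-tail : ¬ T (isRepresentative D a₀) → ConnectedBelow k h₀ t₀
    head-to-tail ¬rep =
      subst₂ (ConnectedBelow k) (partner-opp-tail D a₀ π≢a₀) (partner-opp-head D a₀ π≢a₀)
        (fwd (partner D a₀) (subst (toℕ (partner D a₀) <_) a₀≡k π<a₀) here)
      where
      π<a₀ : toℕ (partner D a₀) < toℕ a₀
      π<a₀ = non-representative D a₀ ¬rep
      π≢a₀ : partner D a₀ ≢ a₀
      π≢a₀ π≡a₀ = ℕ.<-irrefl (cong toℕ π≡a₀) π<a₀

    unchanged : ¬ T (isRepresentative D a₀) → ∀ {u v} → ConnectedBelow (suc k) u v → ConnectedBelow k u v
    unchanged ¬rep p with joined⁺ p
    ... | inj₁ q              = q
    ... | inj₂ (inj₁ (q , r)) = connectedBelow-trans q (connectedBelow-trans (connectedBelow-sym (head-to-tail ¬rep)) r)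
    ... | inj₂ (inj₂ (q , r)) = connectedBelow-trans q (connectedBelow-trans (head-to-tail ¬rep) r)

    module _ (conn? : ∀ u v → Dec (ConnectedBelow k u v)) where
      private
        module Before = Roots conn?
        module After  = Roots (decide conn?)

      lost-root : ∀ {v} → T (Before.isRoot v) → ¬ T (After.isRoot v) → ∃ λ u → toℕ u < toℕ v ×
        ((ConnectedBelow k u t₀ × ConnectedBelow k v h₀) ⊎ (ConnectedBelow k u h₀ × ConnectedBelow k v t₀))
      lost-root root ¬root′ with After.non-root ¬root′
      ... | u , u<v , p with joined⁺ p
      ...   | inj₁ q              = ⊥-elim (Before.root⁻ root u u<v q)
      ...   | inj₂ (inj₁ (q , r)) = u , u<v , inj₁ (q , connectedBelow-sym r)
      ...   | inj₂ (inj₂ (q , r)) = u , u<v , inj₂ (q , connectedBelow-sym r)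

      -- Two roots lost at opposite endpoints x, y of a₀: the larger one would be connected to
      -- the smaller one's witness, which has an even smaller index.
      lost-roots-crossed : ∀ {u v u′ v′ x y} → T (Before.isRoot v) → T (Before.isRoot v′) →
        toℕ u < toℕ v → toℕ u′ < toℕ v′ → ConnectedBelow k u x → ConnectedBelow k v y →
        ConnectedBelow k u′ y → ConnectedBelow k v′ x → v ≡ v′
      lost-roots-crossed {u} {v} {u′} {v′} root root′ u<v u′<v′ u~x v~y u′~y v′~x with ℕ.<-cmp (toℕ v) (toℕ v′)
      ... | tri< v<v′ _ _ = ⊥-elim (Before.root⁻ root′ u (ℕ.<-trans u<v v<v′) (connectedBelow-trans u~x (connectedBelow-sym v′~x)))
      ... | tri≈ _ v≡v′ _ = Fin.toℕ-injective v≡v′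
      ... | tri> _ _ v′<v = ⊥-elim (Before.root⁻ root u′ (ℕ.<-trans u′<v′ v′<v) (connectedBelow-trans u′~y (connectedBelow-sym v~y)))

      lost-root-unique : ∀ v v′ → T (Before.isRoot v ∧ not (After.isRoot v)) → T (Before.isRoot v′ ∧ not (After.isRoot v′)) → v ≡ v′
      lost-root-unique v v′ lost lost′ with Equivalence.to T-∧ lost | Equivalence.to T-∧ lost′
      ... | root , ¬root′ | root₂ , ¬root₂′ with lost-root root (T-not⇒¬T ¬root′) | lost-root root₂ (T-not⇒¬T ¬root₂′)
      ... | _ , _ , inj₁ (_ , v~h) | _ , _ , inj₁ (_ , v′~h) =
        Before.roots-unique connectedBelow-sym root root₂ (connectedBelow-trans v~h (connectedBelow-sym v′~h))
      ... | _ , _ , inj₂ (_ , v~t) | _ , _ , inj₂ (_ , v′~t) =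
        Before.roots-unique connectedBelow-sym root root₂ (connectedBelow-trans v~t (connectedBelow-sym v′~t))
      ... | _ , u<v , inj₁ (u~t , v~h) | _ , u′<v′ , inj₂ (u′~h , v′~t) = lost-roots-crossed root root₂ u<v u′<v′ u~t v~h u′~h v′~t
      ... | _ , u<v , inj₂ (u~h , v~t) | _ , u′<v′ , inj₁ (u′~t , v′~h) = lost-roots-crossed root root₂ u<v u′<v′ u~h v~t u′~t v′~h

      roots-step : Before.roots ≤ After.roots ℕ.+ indicator (isRepresentative D a₀)
      roots-step with isRepresentative D a₀ in rep
      ... | false = ℕ.≤-reflexive (trans (roots-cong conn? (decide conn?) (λ u v → mk⇔ lift (unchanged (λ t → subst T rep t))))
                                         (sym (ℕ.+-identityʳ _)))
      ... | true  = begin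
        Before.roots
          ≡⟨ count-split (n D) Before.isRoot After.isRoot ⟩
        count (allFin (n D)) (λ v → Before.isRoot v ∧ After.isRoot v) ℕ.+ count (allFin (n D)) (λ v → Before.isRoot v ∧ not (After.isRoot v))
          ≤⟨ ℕ.+-mono-≤ (count-mono (n D) (λ v → proj₂ ∘ Equivalence.to T-∧)) (count≤1 (n D) _ lost-root-unique) ⟩
        After.roots ℕ.+ 1 ∎
        where open ℕ.≤-Reasoning

    edges-step : edgesBelow k ℕ.+ indicator (isRepresentative D a₀) ≤ edgesBelow (suc k)
    edges-step = begin
      edgesBelow k ℕ.+ indicator (isRepresentative D a₀)
        ≤⟨ ℕ.+-mono-≤ (ℕ.≤-reflexive (sym earlier)) a₀-counted ⟩
      count (allFin (m D)) (λ a → P a ∧ (toℕ a ℕ.<ᵇ k)) ℕ.+ count (allFin (m D)) (λ a → P a ∧ not (toℕ a ℕ.<ᵇ k))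
        ≡⟨ count-split (m D) P (λ a → toℕ a ℕ.<ᵇ k) ⟨
      edgesBelow (suc k) ∎
      where
      open ℕ.≤-Reasoning
      P : Fin (m D) → Bool
      P a = isRepresentative D a ∧ (toℕ a ℕ.<ᵇ suc k)
      earlier : count (allFin (m D)) (λ a → P a ∧ (toℕ a ℕ.<ᵇ k)) ≡ edgesBelow k
      earlier = count-cong (m D) (λ a → drop-middle (isRepresentative D a)
                  (λ a<k → ℕ.<⇒<ᵇ (ℕ.m<n⇒m<1+n (ℕ.<ᵇ⇒< (toℕ a) k a<k))))
        where
        drop-middle : ∀ r {x y} → (T y → T x) → (r ∧ x) ∧ y ≡ r ∧ y
        drop-middle false             y⇒x = refl
        drop-middle true  {x} {false} y⇒x = Data.Bool.Properties.∧-zeroʳ x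
        drop-middle true  {x} {true}  y⇒x with x | y⇒x tt
        ... | true | _ = refl
      a₀-counted : indicator (isRepresentative D a₀) ≤ count (allFin (m D)) (λ a → P a ∧ not (toℕ a ℕ.<ᵇ k))
      a₀-counted with isRepresentative D a₀ in rep
      ... | false = z≤n
      ... | true  = 1≤count (m D) _ a₀ (Equivalence.from T-∧
                      (Equivalence.from T-∧ (Equivalence.from T-≡ rep , ℕ.<⇒<ᵇ a₀<1+k) ,
                       ¬T⇒T-not (λ a₀<k → ℕ.<-irrefl a₀≡k (ℕ.<ᵇ⇒< (toℕ a₀) k a₀<k))))

  -- Adding the arcs one at a time, each part of E(D) merges at most two components.
  invariant : ∀ k → k ≤ m D →
    Σ (∀ u v → Dec (ConnectedBelow k u v)) λ conn? → n D ≤ Roots.roots conn? ℕ.+ edgesBelow k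
  invariant zero _ = connectedBelow-zero? , ℕ.≤-trans (ℕ.≤-reflexive (sym all-roots)) (ℕ.m≤m+n _ (edgesBelow 0))
    where
    all-roots : Roots.roots connectedBelow-zero? ≡ n D
    all-roots = trans (count-cong (n D) (λ v → Equivalence.to T-≡
                        (Roots.root⁺ connectedBelow-zero? (λ u u<v p → ℕ.<-irrefl (cong toℕ (connectedBelow-zero⇒≡ p)) u<v))))
                      (count-true (n D))
  invariant (suc k) 1+k≤m with invariant k (ℕ.<⇒≤ 1+k≤m)
  ... | conn? , n≤ = Step.decide k a₀ a₀≡k conn? , (begin
    n D                                                           ≤⟨ n≤ ⟩
    Roots.roots conn? ℕ.+ edgesBelow k                            ≤⟨ ℕ.+-monoˡ-≤ (edgesBelow k) (Step.roots-step k a₀ a₀≡k conn?) ⟩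
    (roots′ ℕ.+ indicator (isRepresentative D a₀)) ℕ.+ edgesBelow k ≡⟨ ℕ.+-assoc roots′ _ _ ⟩
    roots′ ℕ.+ (indicator (isRepresentative D a₀) ℕ.+ edgesBelow k) ≡⟨ cong (roots′ ℕ.+_) (ℕ.+-comm _ (edgesBelow k)) ⟩
    roots′ ℕ.+ (edgesBelow k ℕ.+ indicator (isRepresentative D a₀)) ≤⟨ ℕ.+-monoʳ-≤ roots′ (Step.edges-step k a₀ a₀≡k) ⟩
    roots′ ℕ.+ edgesBelow (suc k)                                 ∎)
    where
    open ℕ.≤-Reasoning
    a₀ : Fin (m D)
    a₀ = fromℕ< 1+k≤m
    a₀≡k : toℕ a₀ ≡ k
    a₀≡k = Fin.toℕ-fromℕ< 1+k≤m
    roots′ : ℕ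
    roots′ = Roots.roots (Step.decide k a₀ a₀≡k conn?)

vertices≤edges+components : ∀ D (conn? : ∀ u v → Dec (Connected D u v)) → n D ≤ numEdges D ℕ.+ numComponents D conn?
vertices≤edges+components D conn? with Connectivity.invariant D (m D) ℕ.≤-refl
... | connBelow? , n≤ = subst (n D ≤_) (trans (cong₂ ℕ._+_ same-roots all-edges) (ℕ.+-comm _ (numEdges D))) n≤
  where
  open Connectivity D
  same-roots : Roots.roots connBelow? ≡ numComponents D conn?
  same-roots = roots-cong connBelow? conn? connectedBelow-all⇔
  all-edges : edgesBelow (m D) ≡ numEdges D
  all-edges = count-cong (m D) (λ a → trans (cong (isRepresentative D a ∧_) (Equivalence.to T-≡ (ℕ.<⇒<ᵇ (Fin.toℕ<n a))))
                                           (Data.Bool.Properties.∧-identityʳ _))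


module AtY+2 (y : ℚ) (y≢0 : y ≢ 0ℚ) (y≢-1 : y ≢ - 1ℚ) where

  u iu t : ℚ
  u  = y + 1ℚ
  iu = 1ℚ ÷' u
  t  = 1ℚ ÷' y

  u*iu≡1 : u * iu ≡ 1ℚ
  u*iu≡1 = *-÷'-inverse u (λ u≡0 → y≢-1 (trans (solve 1 (λ y → y := y :+ con 1ℚ :- con 1ℚ) refl y) (cong (_- 1ℚ) u≡0)))

  y*t≡1 : y * t ≡ 1ℚ
  y*t≡1 = *-÷'-inverse y y≢0

  -- At x = y + 2 and y/(y + 1): (x − 1)(y/(y + 1) − 1) = −1 and (y + 1)/y = 1 + 1/y.
  T1-at-y+2 : ∀ D conn? P → T1 D conn? P (y + 1ℚ + 1ℚ) (y ÷' u) ≡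
    (y * iu) ^ numEdges D * ((- u) ^ n D * iu ^ numComponents D conn?) * eval3 P (- 1ℚ) (1ℚ + t) 1ℚ
  T1-at-y+2 D conn? P = begin
    T1 D conn? P (y + 1ℚ + 1ℚ) (y ÷' u)
      ≡⟨ cong (T1 D conn? P (y + 1ℚ + 1ℚ)) (÷'-by-inverse y u iu u*iu≡1) ⟩
    (((y * iu) ^ E) ÷' ((y * iu - 1ℚ) ^ n D * (y + 1ℚ + 1ℚ - 1ℚ) ^ c))
      * eval3 P ((y + 1ℚ + 1ℚ - 1ℚ) * (y * iu - 1ℚ)) (1ℚ ÷' (y * iu)) 1ℚ
      ≡⟨ cong₂ (λ a b → (((y * iu) ^ E) ÷' (b ^ n D * a ^ c)) * eval3 P (a * b) (1ℚ ÷' (y * iu)) 1ℚ) x-1≡u y′-1≡-iu ⟩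
    (((y * iu) ^ E) ÷' ((- iu) ^ n D * u ^ c)) * eval3 P (u * - iu) (1ℚ ÷' (y * iu)) 1ℚ
      ≡⟨ cong₂ _*_ (÷'-by-inverse ((y * iu) ^ E) ((- iu) ^ n D * u ^ c) ((- u) ^ n D * iu ^ c) denominator-inverse)
                   (cong₂ (λ q d → eval3 P q d 1ℚ) u*-iu≡-1 (trans (÷'-by-inverse 1ℚ (y * iu) (1ℚ + t) y′*[1+t]≡1) (ℚ.*-identityˡ (1ℚ + t)))) ⟩
    (y * iu) ^ E * ((- u) ^ n D * iu ^ c) * eval3 P (- 1ℚ) (1ℚ + t) 1ℚ ∎
    where
    open ≡-Reasoning
    E c : ℕ
    E = numEdges D
    c = numComponents D conn?
    x-1≡u : y + 1ℚ + 1ℚ - 1ℚ ≡ u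
    x-1≡u = solve 1 (λ y → y :+ con 1ℚ :+ con 1ℚ :- con 1ℚ := y :+ con 1ℚ) refl y
    y′-1≡-iu : y * iu - 1ℚ ≡ - iu
    y′-1≡-iu = trans (cong (λ z → y * iu - z) (sym u*iu≡1)) (solve 2 (λ y i → y :* i :- (y :+ con 1ℚ) :* i := :- i) refl y iu)
    u*-iu≡-1 : u * - iu ≡ - 1ℚ
    u*-iu≡-1 = trans (sym (ℚ.neg-distribʳ-* u iu)) (cong -_ u*iu≡1)
    y′*[1+t]≡1 : y * iu * (1ℚ + t) ≡ 1ℚ
    y′*[1+t]≡1 = trans (solve 3 (λ y i t → y :* i :* (con 1ℚ :+ t) := (y :+ y :* t) :* i) refl y iu t)
                   (trans (cong (λ z → (y + z) * iu) y*t≡1) u*iu≡1)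
    denominator-inverse : (- iu) ^ n D * u ^ c * ((- u) ^ n D * iu ^ c) ≡ 1ℚ
    denominator-inverse =
      trans (ℚ*.interchange ((- iu) ^ n D) (u ^ c) ((- u) ^ n D) (iu ^ c))
        (trans (cong₂ _*_ (^-inverse (n D) -iu*-u≡1) (^-inverse c u*iu≡1)) (ℚ.*-identityˡ 1ℚ))
      where
      -iu*-u≡1 : - iu * - u ≡ 1ℚ
      -iu*-u≡1 = trans (solve 2 (λ i u → (:- i) :* (:- u) := u :* i) refl iu u) u*iu≡1

  prefactor : ∀ {E c k e} → e ℕ.+ k ≡ E ℕ.+ c → u ^ e * ((y * iu) ^ E * ((- u) ^ k * iu ^ c)) ≡ y ^ E * (- 1ℚ) ^ k
  prefactor {E} {c} {k} {e} e+k≡E+c = begin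
    u ^ e * ((y * iu) ^ E * ((- u) ^ k * iu ^ c))
      ≡⟨ cong₂ (λ a b → u ^ e * (a * (b * iu ^ c))) (^-distribʳ-* y iu E) (trans (cong (_^ k) -u≡-1*u) (^-distribʳ-* (- 1ℚ) u k)) ⟩
    u ^ e * (y ^ E * iu ^ E * ((- 1ℚ) ^ k * u ^ k * iu ^ c))
      ≡⟨ solve 7 (λ U Y I N V J W → U :* (Y :* I :* (N :* V :* J)) := (U :* V) :* (I :* J) :* (Y :* N))
               refl (u ^ e) (y ^ E) (iu ^ E) ((- 1ℚ) ^ k) (u ^ k) (iu ^ c) 0ℚ ⟩
    u ^ e * u ^ k * (iu ^ E * iu ^ c) * (y ^ E * (- 1ℚ) ^ k)
      ≡⟨ cong₂ (λ a b → a * b * (y ^ E * (- 1ℚ) ^ k)) (sym (^-distribˡ-+-* u e k)) (sym (^-distribˡ-+-* iu E c)) ⟩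
    u ^ (e ℕ.+ k) * iu ^ (E ℕ.+ c) * (y ^ E * (- 1ℚ) ^ k)
      ≡⟨ cong (λ a → u ^ a * iu ^ (E ℕ.+ c) * (y ^ E * (- 1ℚ) ^ k)) e+k≡E+c ⟩
    u ^ (E ℕ.+ c) * iu ^ (E ℕ.+ c) * (y ^ E * (- 1ℚ) ^ k)
      ≡⟨ trans (cong (_* (y ^ E * (- 1ℚ) ^ k)) (^-inverse (E ℕ.+ c) u*iu≡1)) (ℚ.*-identityˡ _) ⟩
    y ^ E * (- 1ℚ) ^ k ∎
    where
    open ≡-Reasoning
    -u≡-1*u : - u ≡ - 1ℚ * u
    -u≡-1*u = trans (cong -_ (sym (ℚ.*-identityˡ u))) (ℚ.neg-distribˡ-* 1ℚ u)

  -- Each acyclic D ∖ S keeps at most |E(D)| arcs, so y^|E| cancels every 1/y^|A ∖ S|.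
  acyclicWeight-at-1/y : ∀ D acyclic? → y ^ numEdges D * acyclicWeight D acyclic? t ≡ acyclicSum D acyclic? y
  acyclicWeight-at-1/y D acyclic? =
    trans (*-distribˡ-sumℚ (y ^ numEdges D) (allSubsets (m D)) _)
          (sumℚ-cong (allSubsets (m D)) (λ S → scaled S (acyclic? S)))
    where
    scaled : ∀ S (r : Dec (Acyclic D S)) →
      y ^ numEdges D * (if does r then t ^ ∣ ∁ S ∣ else 0ℚ) ≡ (if does r then y ^ (numEdges D ℕ.∸ ∣ ∁ S ∣) else 0ℚ)
    scaled S (no _)        = ℚ.*-zeroʳ (y ^ numEdges D)
    scaled S (yes acyclic) = begin
      y ^ E * t ^ k                      ≡⟨ cong (λ a → y ^ a * t ^ k) (sym (ℕ.m∸n+n≡m (kept-arcs≤numEdges D S acyclic))) ⟩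
      y ^ (E ℕ.∸ k ℕ.+ k) * t ^ k        ≡⟨ cong (_* t ^ k) (^-distribˡ-+-* y (E ℕ.∸ k) k) ⟩
      y ^ (E ℕ.∸ k) * y ^ k * t ^ k      ≡⟨ ℚ.*-assoc (y ^ (E ℕ.∸ k)) (y ^ k) (t ^ k) ⟩
      y ^ (E ℕ.∸ k) * (y ^ k * t ^ k)    ≡⟨ trans (cong (y ^ (E ℕ.∸ k) *_) (^-inverse k y*t≡1)) (ℚ.*-identityʳ _) ⟩
      y ^ (E ℕ.∸ k)                      ∎
      where
      open ≡-Reasoning
      E k : ℕ
      E = numEdges D
      k = ∣ ∁ S ∣

theorem7p7 : (D : MixedGraph)
    → (conn? : ∀ u v → Dec (Connected D u v))
    → (acyc? : ∀ S → Dec (Acyclic D S))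
    → (P : Poly3) → IsBPoly D P
    → (y : ℚ) → y ≢ 0ℚ → y ≢ - 1ℚ
    → ((y + 1ℚ) ^ ((numEdges D ℕ.+ numComponents D conn?) ℕ.∸ n D))
        * T1 D conn? P (y + 1ℚ + 1ℚ) (y ÷' (y + 1ℚ))
      ≡ acyclicSum D acyc? y
theorem7p7 D conn? acyc? P isB y y≢0 y≢-1 = begin
  u ^ e * T1 D conn? P (y + 1ℚ + 1ℚ) (y ÷' u)
    ≡⟨ cong (u ^ e *_) (trans (T1-at-y+2 D conn? P) (cong (prefix *_) (B-at-minus-one D acyc? P isB t))) ⟩
  u ^ e * (prefix * (sign * W))
    ≡⟨ ℚ.*-assoc (u ^ e) prefix (sign * W) ⟨
  u ^ e * prefix * (sign * W)
    ≡⟨ cong (_* (sign * W)) (prefactor {numEdges D} {numComponents D conn?} {n D} {e} (ℕ.m∸n+n≡m (vertices≤edges+components D conn?))) ⟩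
  y ^ numEdges D * sign * (sign * W)
    ≡⟨ solve 3 (λ a s w → a :* s :* (s :* w) := a :* (s :* s) :* w) refl (y ^ numEdges D) sign W ⟩
  y ^ numEdges D * (sign * sign) * W
    ≡⟨ cong (λ x → y ^ numEdges D * x * W) (^-inverse (n D) refl) ⟩
  y ^ numEdges D * 1ℚ * W
    ≡⟨ cong (_* W) (ℚ.*-identityʳ (y ^ numEdges D)) ⟩
  y ^ numEdges D * W
    ≡⟨ acyclicWeight-at-1/y D acyc? ⟩
  acyclicSum D acyc? y ∎
  where
  open ≡-Reasoning
  open AtY+2 y y≢0 y≢-1
  e : ℕ
  e = (numEdges D ℕ.+ numComponents D conn?) ℕ.∸ n D
  prefix sign W : ℚ
  prefix = (y * iu) ^ numEdges D * ((- u) ^ n D * iu ^ numComponents D conn?)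
  sign = (- 1ℚ) ^ n D
  W = acyclicWeight D acyc? t
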